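{- Let $m\ge 3$, let $C_m=v_0v_1\cdots v_{m-1}v_0$ be a cycle, let $i\ne j$ be indices in $\{0,\dots,m-1\}$, and let $a\ge 1$, $b\ge 2$ be integers. Let $G^*$ be the unicyclic graph obtained from $C_m$ by attaching a path $P_a$ to $v_i$ and a path $P_b$ to $v_j$, where the vertices of the path attached to $v_j$ are labelled $u_1,\dots,u_b$ consecutively with $u_1$ adjacent to $v_j$. For integers $h\ge 1$ and $1\le t\le b-1$, let $G^{(1)}_{u_t,h}$ be the graph obtained from $G^*$ by attaching $h$ pendant vertices to $u_t$, and let $G^{(2)}_{v_j,h}$ be the graph obtained from $G^*$ by attaching $h$ pendant vertices to $v_j$. Let $n_1=a+m-1$ and $n_2=b-t$. Then $$D'\big(G^{(2)}_{v_j,h}\big)-D'\big(G^{(1)}_{u_t,h}\big)=2ht\,[2(n_2-n_1)-1].$$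
   Context: All graphs are finite, simple and connected. For a graph $G$, $d_G(x,y)$ denotes the distance, $D_G(x)=\sum_{y\in V(G)}d_G(x,y)$, and $d_G(x)$ is the degree of $x$. The degree distance is $D'(G)=\sum_{x\in V(G)}d_G(x)D_G(x)$. Attaching a path $P_s$ ($s\ge1$) to a vertex $w$ means adding $s$ new vertices $w_1,\dots,w_s$ with edges $ww_1,w_1w_2,\dots,w_{s-1}w_s$; attaching $h$ pendant vertices to $w$ means adding $h$ new vertices each joined only to $w$. -}

module Defs where

open import Data.Nat using (ℕ; zero; suc; _+_; _*_; _∸_; _≡ᵇ_)
open import Data.Bool using (Bool; true; false; _∧_; _∨_; if_then_else_)
open import Data.List using (List; []; _∷_; _++_; map; upTo; length; filter)
open import Data.Nat.ListAction using (sum)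
open import Data.Bool.ListAction using (any)
open import Data.Product using (_×_; _,_)

-- A finite simple graph given by its number of vertices N (vertices are 0,…,N-1)
-- and a list of (undirected) edges.
record Graph : Set where
  constructor graph
  field
    N     : ℕ
    edges : List (ℕ × ℕ)
open Graph public

adj : Graph → ℕ → ℕ → Bool
adj G x y = any (λ { (p , q) → ((p ≡ᵇ x) ∧ (q ≡ᵇ y)) ∨ ((p ≡ᵇ y) ∧ (q ≡ᵇ x)) }) (edges G)

deg : Graph → ℕ → ℕ
deg G x = length (filter (λ y → Data.Bool.T? (adj G x y)) (upTo (N G)))
  where import Data.Bool

ball : Graph → ℕ → ℕ → ℕ → Bool
ball G zero    x y = x ≡ᵇ y
ball G (suc k) x y = ball G k x y ∨ any (λ z → ball G k x z ∧ adj G z y) (upTo (N G))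

-- least k in [c, c + fuel) with p k (returns c + fuel if none)
least : (ℕ → Bool) → ℕ → ℕ → ℕ
least p c zero       = c
least p c (suc fuel) = if p c then c else least p (suc c) fuel

-- distance d_G(x,y): length of a shortest x–y walk (= shortest path);
-- in a connected graph on N vertices it is < N, so searching k < N suffices.
dist : Graph → ℕ → ℕ → ℕ
dist G x y = least (λ k → ball G k x y) 0 (N G)

D : Graph → ℕ → ℕ
D G x = sum (map (dist G x) (upTo (N G)))

D′ : Graph → ℕ
D′ G = sum (map (λ x → deg G x * D G x) (upTo (N G)))

-- Vertex labelling:
--   v_k              = k              (0 ≤ k < m)      cycle C_m
--   path P_a at v_i  = m, …, m+a-1    (m adjacent to v_i)
--   u_k              = m+a+k-1        (1 ≤ k ≤ b)      path P_b at v_j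
--   pendant vertices = m+a+b, …, m+a+b+h-1

cycleEdges : ℕ → List (ℕ × ℕ)
cycleEdges m = (m ∸ 1 , 0) ∷ map (λ k → (k , suc k)) (upTo (m ∸ 1))

pathEdges : ℕ → ℕ → ℕ → List (ℕ × ℕ)
pathEdges w start zero      = []
pathEdges w start (suc len) = (w , start) ∷ map (λ k → (start + k , start + suc k)) (upTo len)

pendantEdges : ℕ → ℕ → ℕ → List (ℕ × ℕ)
pendantEdges w start h = map (λ k → (w , start + k)) (upTo h)

GstarEdges : (m i j a b : ℕ) → List (ℕ × ℕ)
GstarEdges m i j a b = cycleEdges m ++ pathEdges i m a ++ pathEdges j (m + a) b

u : (m a k : ℕ) → ℕ
u m a k = m + a + k ∸ 1

G1 : (m i j a b t h : ℕ) → Graph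
G1 m i j a b t h = graph (m + a + b + h)
  (GstarEdges m i j a b ++ pendantEdges (u m a t) (m + a + b) h)

G2 : (m i j a b h : ℕ) → Graph
G2 m i j a b h = graph (m + a + b + h)
  (GstarEdges m i j a b ++ pendantEdges j (m + a + b) h)

module Submission where

-- By the handshake lemma D′(G) = Σ_{pq ∈ E(G)} (D(p) + D(q)). Let G_w be G* with h pendant vertices
-- at w, so that G^{(2)} = G_{v_j} and G^{(1)} = G_{u_t}. Distances between vertices of G* do not depend
-- on w, and a pendant vertex lies at distance d(w,y) + 1 from every other vertex y; hence D′(G_w) + 2h
-- is a w-independent quantity plus h Σ_{pq ∈ E(G*)} (d(p,w) + d(q,w) + 2) + h (2 D(w) + |V|).
-- As v_j is a cut vertex, d(x,u_t) = d(x,v_j) + t for x off P_b, while d(u_k,u_l) = |k - l|; summing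
-- over the edges of P_b telescopes, and both D′ values come out in closed form in terms of
-- P_t = Σ_{1 ≤ k ≤ b} |k - t|, where P_0 = P_t + t(b - t) + t gives the difference.
-- All lower bounds on distances come from potentials f with |f(p) - f(q)| ≤ 1 along every edge,
-- which satisfy f(y) - f(x) ≤ d(x,y).

open import Defs
open import Data.Nat using (ℕ; _≤_; _<_; _∸_)
open import Relation.Binary.PropositionalEquality using (_≡_; _≢_)
import Data.Nat as ℕ

module FiniteSums where
  open import Data.Nat using (ℕ; zero; suc; _+_; _*_; _∸_; _<_; ∣_-_∣)
  open import Data.Nat.Properties
  open import Data.Sum using (inj₁; inj₂)
  open import Data.List using ([]; _∷_; map; upTo; applyUpTo)
  open import Data.Nat.ListAction using (sum)
  open import Function using (_∘_)
  open import Relation.Binary.PropositionalEquality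
  open import Algebra.Properties.CommutativeSemigroup +-commutativeSemigroup using (interchange; xy∙z≈xz∙y)
  open import Data.Nat.Tactic.RingSolver using (solve-∀)
  open ≡-Reasoning

  ∑ : (ℕ → ℕ) → ℕ → ℕ
  ∑ f zero    = 0
  ∑ f (suc n) = ∑ f n + f n

  ∑-unfoldˡ : ∀ f n → ∑ f (suc n) ≡ f 0 + ∑ (f ∘ suc) n
  ∑-unfoldˡ f zero    = +-comm 0 (f 0)
  ∑-unfoldˡ f (suc n) = begin
    ∑ f (suc n) + f (suc n)          ≡⟨ cong (_+ f (suc n)) (∑-unfoldˡ f n) ⟩
    f 0 + ∑ (f ∘ suc) n + f (suc n)  ≡⟨ +-assoc (f 0) _ _ ⟩
    f 0 + ∑ (f ∘ suc) (suc n)        ∎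

  sum-map-applyUpTo : ∀ (f g : ℕ → ℕ) n → sum (map f (applyUpTo g n)) ≡ ∑ (f ∘ g) n
  sum-map-applyUpTo f g zero    = refl
  sum-map-applyUpTo f g (suc n) = begin
    f (g 0) + sum (map f (applyUpTo (g ∘ suc) n))  ≡⟨ cong (f (g 0) +_) (sum-map-applyUpTo f (g ∘ suc) n) ⟩
    f (g 0) + ∑ (f ∘ g ∘ suc) n                    ≡⟨ ∑-unfoldˡ (f ∘ g) n ⟨
    ∑ (f ∘ g) (suc n)                              ∎

  sum-map-upTo : ∀ (f : ℕ → ℕ) n → sum (map f (upTo n)) ≡ ∑ f n
  sum-map-upTo f = sum-map-applyUpTo f (λ k → k)

  ∑-cong : ∀ {f g} n → (∀ k → k < n → f k ≡ g k) → ∑ f n ≡ ∑ g n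
  ∑-cong zero    f≗g = refl
  ∑-cong (suc n) f≗g = cong₂ _+_ (∑-cong n (λ k k<n → f≗g k (m<n⇒m<1+n k<n))) (f≗g n ≤-refl)

  ∑-+ : ∀ f g n → ∑ (λ k → f k + g k) n ≡ ∑ f n + ∑ g n
  ∑-+ f g zero    = refl
  ∑-+ f g (suc n) rewrite ∑-+ f g n = interchange (∑ f n) (∑ g n) (f n) (g n)

  ∑-const : ∀ c n → ∑ (λ _ → c) n ≡ n * c
  ∑-const c zero    = refl
  ∑-const c (suc n) rewrite ∑-const c n = +-comm (n * c) c

  ∑-*ʳ : ∀ f n c → ∑ f n * c ≡ ∑ (λ k → f k * c) n
  ∑-*ʳ f zero    c = refl
  ∑-*ʳ f (suc n) c = trans (*-distribʳ-+ c (∑ f n) (f n)) (cong (_+ f n * c) (∑-*ʳ f n c))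

  ∑-split : ∀ f n l → ∑ f (n + l) ≡ ∑ f n + ∑ (λ k → f (n + k)) l
  ∑-split f n zero    rewrite +-identityʳ n = sym (+-identityʳ _)
  ∑-split f n (suc l) rewrite +-suc n l | ∑-split f n l = +-assoc (∑ f n) _ _

  ∑-zero : ∀ f n → (∀ k → k < n → f k ≡ 0) → ∑ f n ≡ 0
  ∑-zero f n f≗0 = trans (∑-cong n f≗0) (trans (∑-const 0 n) (*-zeroʳ n))

  ∑-swap-sum : ∀ {A : Set} (g : ℕ → A → ℕ) xs n →
    ∑ (λ k → sum (map (g k) xs)) n ≡ sum (map (λ x → ∑ (λ k → g k x) n) xs)
  ∑-swap-sum g []       n = ∑-zero _ n (λ _ _ → refl)
  ∑-swap-sum g (x ∷ xs) n =
    trans (∑-+ (λ k → g k x) (λ k → sum (map (g k) xs)) n) (cong (∑ (λ k → g k x) n +_) (∑-swap-sum g xs n))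

  ∑-replace : ∀ f g n p → p < n → (∀ k → k < n → k ≢ p → f k ≡ g k) → f p ≡ 0 → ∑ f n + g p ≡ ∑ g n
  ∑-replace f g (suc n) p p<1+n f≗g fp≡0 with m≤n⇒m<n∨m≡n (≤-pred p<1+n)
  ... | inj₂ refl rewrite fp≡0 | ∑-cong {f} {g} n (λ k k<n → f≗g k (m<n⇒m<1+n k<n) (<⇒≢ k<n)) =
    cong (_+ g n) (+-identityʳ (∑ g n))
  ... | inj₁ p<n = begin
    ∑ f n + f n + g p  ≡⟨ xy∙z≈xz∙y (∑ f n) (f n) (g p) ⟩
    ∑ f n + g p + f n  ≡⟨ cong₂ _+_ (∑-replace f g n p p<n (λ k k<n → f≗g k (m<n⇒m<1+n k<n)) fp≡0)
                                    (f≗g n ≤-refl (λ n≡p → <⇒≢ p<n (sym n≡p))) ⟩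
    ∑ g n + g n        ∎

  ∑-telescope : ∀ (ψ : ℕ → ℕ) n → ∑ (λ k → ψ k + ψ (suc k)) n + ψ 0 + ψ n ≡ 2 * ∑ ψ (suc n)
  ∑-telescope ψ zero    = double (ψ 0)
    where
    double : ∀ x → 0 + x + x ≡ 2 * (0 + x)
    double = solve-∀
  ∑-telescope ψ (suc n) = begin
    ∑ (λ k → ψ k + ψ (suc k)) n + (ψ n + ψ (suc n)) + ψ 0 + ψ (suc n)
      ≡⟨ regroup (∑ (λ k → ψ k + ψ (suc k)) n) (ψ n) (ψ (suc n)) (ψ 0) ⟩
    ∑ (λ k → ψ k + ψ (suc k)) n + ψ 0 + ψ n + 2 * ψ (suc n)
      ≡⟨ cong (_+ 2 * ψ (suc n)) (∑-telescope ψ n) ⟩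
    2 * ∑ ψ (suc n) + 2 * ψ (suc n)
      ≡⟨ *-distribˡ-+ 2 (∑ ψ (suc n)) (ψ (suc n)) ⟨
    2 * ∑ ψ (suc (suc n)) ∎
    where
    regroup : ∀ A x y z → A + (x + y) + z + y ≡ A + z + x + 2 * y
    regroup = solve-∀

  ∑-reverse : ∀ t → ∑ (λ k → t ∸ suc k) t ≡ ∑ (λ k → k) t
  ∑-reverse zero    = refl
  ∑-reverse (suc t) = trans (∑-unfoldˡ (λ k → suc t ∸ suc k) t) (trans (cong (t +_) (∑-reverse t)) (+-comm t _))

  ∑-suc : ∀ n → ∑ suc n ≡ ∑ (λ k → k) n + n
  ∑-suc n = trans (∑-+ (λ _ → 1) (λ k → k) n) (trans (cong (_+ ∑ (λ k → k) n) (trans (∑-const 1 n) (*-identityʳ n))) (+-comm n _))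

  ∑-suc-∣-∣ : ∀ t s → ∑ suc (t + s) ≡ ∑ (λ k → ∣ suc k - t ∣) (t + s) + t * s + t
  ∑-suc-∣-∣ t zero rewrite +-identityʳ t | *-zeroʳ t = begin
    ∑ suc t                               ≡⟨ ∑-suc t ⟩
    ∑ (λ k → k) t + t                     ≡⟨ cong (_+ t) (sym (∑-reverse t)) ⟩
    ∑ (λ k → t ∸ suc k) t + t             ≡⟨ cong (_+ t) (∑-cong t (λ k k<t → sym (m≤n⇒∣m-n∣≡n∸m k<t))) ⟩
    ∑ (λ k → ∣ suc k - t ∣) t + t         ≡⟨ cong (_+ t) (sym (+-identityʳ _)) ⟩
    ∑ (λ k → ∣ suc k - t ∣) t + 0 + t     ∎
  ∑-suc-∣-∣ t (suc s) rewrite +-suc t s = begin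
    ∑ suc (t + s) + suc (t + s)                            ≡⟨ cong (_+ suc (t + s)) (∑-suc-∣-∣ t s) ⟩
    R + t * s + t + suc (t + s)                            ≡⟨ regroup R t s ⟩
    R + suc s + t * suc s + t                              ≡⟨ cong (λ v → R + v + t * suc s + t) (sym last) ⟩
    R + ∣ suc (t + s) - t ∣ + t * suc s + t                ∎
    where
    R : ℕ
    R = ∑ (λ k → ∣ suc k - t ∣) (t + s)
    last : ∣ suc (t + s) - t ∣ ≡ suc s
    last = trans (cong ∣_- t ∣ (sym (+-suc t s))) (trans (∣-∣-comm (t + suc s) t) (∣m-m+n∣≡n t (suc s)))
    regroup : ∀ R t s → R + t * s + t + suc (t + s) ≡ R + suc s + t * suc s + t
    regroup = solve-∀

module Distance where
  open import Data.Nat using (ℕ; zero; suc; _+_; _≤_; _<_; z≤n; s≤s; _≡ᵇ_)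
  open import Data.Nat.Properties
  open import Data.Bool using (Bool; true; false; _∧_; _∨_; T)
  open import Data.List using (List; _∷_; upTo)
  open import Data.Bool.ListAction using (any)
  open import Data.List.Membership.Propositional using (_∈_)
  open import Data.List.Membership.Propositional.Properties using (∈-upTo⁺; ∈-upTo⁻)
  open import Data.List.Relation.Unary.Any using (here; there)
  open import Data.Product using (_×_; _,_; proj₁; proj₂; ∃)
  open import Data.Sum using (_⊎_; inj₁; inj₂)
  open import Data.Empty using (⊥-elim)
  open import Relation.Nullary using (yes; no)
  open import Relation.Binary.PropositionalEquality

  ∨≡true⁻ : ∀ a b → a ∨ b ≡ true → a ≡ true ⊎ b ≡ true
  ∨≡true⁻ true  b e = inj₁ refl
  ∨≡true⁻ false b e = inj₂ e

  ∨≡true⁺ˡ : ∀ a b → a ≡ true → a ∨ b ≡ true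
  ∨≡true⁺ˡ true b e = refl

  ∨≡true⁺ʳ : ∀ a b → b ≡ true → a ∨ b ≡ true
  ∨≡true⁺ʳ true  b e = refl
  ∨≡true⁺ʳ false b e = e

  ∧≡true⁻ : ∀ a b → a ∧ b ≡ true → a ≡ true × b ≡ true
  ∧≡true⁻ true true e = refl , refl

  ∧≡true⁺ : ∀ a b → a ≡ true → b ≡ true → a ∧ b ≡ true
  ∧≡true⁺ true true _ _ = refl

  ≡ᵇ≡true⁻ : ∀ a b → (a ≡ᵇ b) ≡ true → a ≡ b
  ≡ᵇ≡true⁻ a b e = ≡ᵇ⇒≡ a b (subst T (sym e) _)

  ≡ᵇ-refl : ∀ a → (a ≡ᵇ a) ≡ true
  ≡ᵇ-refl zero    = refl
  ≡ᵇ-refl (suc a) = ≡ᵇ-refl a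

  any≡true⁻ : ∀ {A : Set} (p : A → Bool) xs → any p xs ≡ true → ∃ λ z → z ∈ xs × p z ≡ true
  any≡true⁻ p (x ∷ xs) e with p x in px
  ... | true  = x , here refl , px
  ... | false with any≡true⁻ p xs e
  ... | z , z∈xs , pz = z , there z∈xs , pz

  any≡true⁺ : ∀ {A : Set} (p : A → Bool) {xs z} → z ∈ xs → p z ≡ true → any p xs ≡ true
  any≡true⁺ p {x ∷ xs} (here refl) pz rewrite pz = refl
  any≡true⁺ p {x ∷ xs} (there z∈xs) pz rewrite any≡true⁺ p z∈xs pz = ∨≡true⁺ʳ (p x) true refl

  Joins : ℕ → ℕ → ℕ → ℕ → Set
  Joins p q x y = (p ≡ x × q ≡ y) ⊎ (p ≡ y × q ≡ x)

  adj⁻ : ∀ G x y → adj G x y ≡ true → ∃ λ p → ∃ λ q → (p , q) ∈ edges G × Joins p q x y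
  adj⁻ G x y e with any≡true⁻ _ (edges G) e
  ... | (p , q) , pq∈ , joins with ∨≡true⁻ _ _ joins
  ... | inj₁ c = p , q , pq∈ , inj₁ (≡ᵇ≡true⁻ _ _ (proj₁ (∧≡true⁻ _ _ c)) , ≡ᵇ≡true⁻ _ _ (proj₂ (∧≡true⁻ _ _ c)))
  ... | inj₂ c = p , q , pq∈ , inj₂ (≡ᵇ≡true⁻ _ _ (proj₁ (∧≡true⁻ _ _ c)) , ≡ᵇ≡true⁻ _ _ (proj₂ (∧≡true⁻ _ _ c)))

  adj⁺ : ∀ G p q → (p , q) ∈ edges G → adj G p q ≡ true
  adj⁺ G p q pq∈ = any≡true⁺ _ pq∈ (∨≡true⁺ˡ _ _ (∧≡true⁺ _ _ (≡ᵇ-refl p) (≡ᵇ-refl q)))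

  adj⁺-flip : ∀ G p q → (p , q) ∈ edges G → adj G q p ≡ true
  adj⁺-flip G p q pq∈ = any≡true⁺ _ pq∈ (∨≡true⁺ʳ _ _ (∧≡true⁺ _ _ (≡ᵇ-refl p) (≡ᵇ-refl q)))

  adj-sym : ∀ G x y → adj G x y ≡ true → adj G y x ≡ true
  adj-sym G x y e with adj⁻ G x y e
  ... | p , q , pq∈ , inj₁ (refl , refl) = adj⁺-flip G p q pq∈
  ... | p , q , pq∈ , inj₂ (refl , refl) = adj⁺ G p q pq∈

  VerticesBounded : Graph → Set
  VerticesBounded G = ∀ p q → (p , q) ∈ edges G → p < N G × q < N G

  adj-bounded : ∀ G → VerticesBounded G → ∀ x y → adj G x y ≡ true → x < N G × y < N G
  adj-bounded G bd x y e with adj⁻ G x y e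
  ... | p , q , pq∈ , inj₁ (refl , refl) = bd p q pq∈
  ... | p , q , pq∈ , inj₂ (refl , refl) = proj₂ (bd p q pq∈) , proj₁ (bd p q pq∈)

  ball-mono : ∀ G k x y → ball G k x y ≡ true → ball G (suc k) x y ≡ true
  ball-mono G k x y e rewrite e = refl

  ball-zero⁻ : ∀ G x y → ball G 0 x y ≡ true → x ≡ y
  ball-zero⁻ G = ≡ᵇ≡true⁻

  ball-step : ∀ G k x z y → z < N G → ball G k x z ≡ true → adj G z y ≡ true → ball G (suc k) x y ≡ true
  ball-step G k x z y z<N xz yz = ∨≡true⁺ʳ _ _ (any≡true⁺ _ (∈-upTo⁺ z<N) (∧≡true⁺ _ _ xz yz))

  ball-trans : ∀ G k l x z y → ball G k x z ≡ true → ball G l z y ≡ true → ball G (k + l) x y ≡ true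
  ball-trans G k zero    x z y xz zy rewrite ball-zero⁻ G z y zy | +-identityʳ k = xz
  ball-trans G k (suc l) x z y xz zy rewrite +-suc k l with ∨≡true⁻ _ _ zy
  ... | inj₁ zy′ = ball-mono G (k + l) x y (ball-trans G k l x z y xz zy′)
  ... | inj₂ step with any≡true⁻ _ (upTo (N G)) step
  ... | z′ , z′∈ , zz′y = ball-step G (k + l) x z′ y (∈-upTo⁻ z′∈)
          (ball-trans G k l x z z′ xz (proj₁ (∧≡true⁻ _ _ zz′y))) (proj₂ (∧≡true⁻ _ _ zz′y))

  Lipschitz : Graph → (ℕ → ℕ) → Set
  Lipschitz G f = ∀ p q → adj G p q ≡ true → f q ≤ suc (f p)

  ball-Lipschitz : ∀ G f → Lipschitz G f → ∀ k x y → ball G k x y ≡ true → f y ≤ f x + k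
  ball-Lipschitz G f L zero    x y e rewrite ball-zero⁻ G x y e = m≤m+n (f y) 0
  ball-Lipschitz G f L (suc k) x y e with ∨≡true⁻ _ _ e
  ... | inj₁ e′ = ≤-trans (ball-Lipschitz G f L k x y e′) (+-monoʳ-≤ (f x) (n≤1+n k))
  ... | inj₂ step with any≡true⁻ _ (upTo (N G)) step
  ... | z , _ , xzy = ≤-trans (L z y (proj₂ (∧≡true⁻ _ _ xzy)))
        (≤-trans (s≤s (ball-Lipschitz G f L k x z (proj₁ (∧≡true⁻ _ _ xzy)))) (≤-reflexive (sym (+-suc (f x) k))))

  least-minimal : ∀ p c fuel k → p k ≡ true → c ≤ k → k < c + fuel → least p c fuel ≤ k
  least-minimal p c zero       k pk c≤k k< = ⊥-elim (<⇒≱ k< (≤-trans (≤-reflexive (+-identityʳ c)) c≤k))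
  least-minimal p c (suc fuel) k pk c≤k k< with p c in pc
  ... | true  = c≤k
  ... | false with m≤n⇒m<n∨m≡n c≤k
  ... | inj₁ c<k  = least-minimal p (suc c) fuel k pk c<k (≤-trans k< (≤-reflexive (+-suc c fuel)))
  ... | inj₂ refl with trans (sym pc) pk
  ... | ()

  least-≤ : ∀ p c fuel → least p c fuel ≤ c + fuel
  least-≤ p c zero       = m≤m+n c 0
  least-≤ p c (suc fuel) with p c
  ... | true  = m≤m+n c (suc fuel)
  ... | false = ≤-trans (least-≤ p (suc c) fuel) (≤-reflexive (sym (+-suc c fuel)))

  least-satisfies : ∀ p c fuel → least p c fuel < c + fuel → p (least p c fuel) ≡ true
  least-satisfies p c zero       lt = ⊥-elim (<-irrefl (sym (+-identityʳ c)) lt)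
  least-satisfies p c (suc fuel) lt with p c in pc
  ... | true  = pc
  ... | false = least-satisfies p (suc c) fuel (≤-trans lt (≤-reflexive (+-suc c fuel)))

  dist-minimal : ∀ G k x y → ball G k x y ≡ true → dist G x y ≤ k
  dist-minimal G k x y e with k <? N G
  ... | yes k<N = least-minimal _ 0 (N G) k e z≤n k<N
  ... | no  k≮N = ≤-trans (least-≤ _ 0 (N G)) (≮⇒≥ k≮N)

  dist-≤-N : ∀ G x y → dist G x y ≤ N G
  dist-≤-N G x y = least-≤ _ 0 (N G)

  ball-dist : ∀ G x y → dist G x y < N G → ball G (dist G x y) x y ≡ true
  ball-dist G x y = least-satisfies _ 0 (N G)

  dist-refl : ∀ G x → dist G x x ≡ 0
  dist-refl G x = n≤0⇒n≡0 (dist-minimal G 0 x x (≡ᵇ-refl x))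

  dist-triangle : ∀ G x y z → dist G x z ≤ dist G x y + dist G y z
  dist-triangle G x y z with dist G x y <? N G | dist G y z <? N G
  ... | yes xy<N | yes yz<N = dist-minimal G _ x z
          (ball-trans G (dist G x y) (dist G y z) x y z (ball-dist G x y xy<N) (ball-dist G y z yz<N))
  ... | no  xy≮N | _        = ≤-trans (dist-≤-N G x z) (≤-trans (≮⇒≥ xy≮N) (m≤m+n _ _))
  ... | yes _    | no yz≮N  = ≤-trans (dist-≤-N G x z) (≤-trans (≮⇒≥ yz≮N) (m≤n+m _ _))

  dist-adj : ∀ G p q → p < N G → adj G p q ≡ true → dist G p q ≤ 1
  dist-adj G p q p<N e = dist-minimal G 1 p q (ball-step G 0 p p q p<N (≡ᵇ-refl p) e)

  dist-chain : ∀ G (g : ℕ → ℕ) L → (∀ s → s < L → dist G (g s) (g (suc s)) ≤ 1) →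
    ∀ k l → k + l ≤ L → dist G (g k) (g (k + l)) ≤ l
  dist-chain G g L step k zero    k≤L rewrite +-identityʳ k | dist-refl G (g k) = z≤n
  dist-chain G g L step k (suc l) k+l<L rewrite +-suc k l =
    ≤-trans (dist-triangle G (g k) (g (k + l)) (g (suc (k + l))))
      (≤-trans (+-mono-≤ (dist-chain G g L step k l (≤-trans (n≤1+n (k + l)) k+l<L)) (step (k + l) k+l<L))
               (≤-reflexive (+-comm l 1)))

  -- The bound f y ≤ f x + N G covers the junk value N G that dist takes on unreachable pairs.
  Lipschitz⇒≤dist : ∀ G f → Lipschitz G f → ∀ x y → f y ≤ f x + N G → f y ≤ f x + dist G x y
  Lipschitz⇒≤dist G f L x y fy≤ with dist G x y <? N G
  ... | yes xy<N = ball-Lipschitz G f L _ x y (ball-dist G x y xy<N)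
  ... | no  xy≮N = subst (λ v → f y ≤ f x + v) (sym (≤-antisym (dist-≤-N G x y) (≮⇒≥ xy≮N))) fy≤

  module _ (G : Graph) (bounded : VerticesBounded G) where

    dist-edge : ∀ p q → (p , q) ∈ edges G → dist G p q ≤ 1
    dist-edge p q pq∈ = dist-adj G p q (proj₁ (bounded p q pq∈)) (adj⁺ G p q pq∈)

    dist-to-Lipschitz : ∀ x → Lipschitz G (λ z → dist G z x)
    dist-to-Lipschitz x p q e = ≤-trans (dist-triangle G q p x)
      (+-monoˡ-≤ (dist G p x) (dist-adj G q p (proj₂ (adj-bounded G bounded p q e)) (adj-sym G p q e)))

    dist-sym≤ : ∀ x y → dist G y x ≤ dist G x y
    dist-sym≤ x y = subst (λ v → dist G y x ≤ v + dist G x y) (dist-refl G x)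
      (Lipschitz⇒≤dist G (λ z → dist G z x) (dist-to-Lipschitz x) x y
        (subst (λ v → dist G y x ≤ v + N G) (sym (dist-refl G x)) (dist-≤-N G y x)))

    dist-sym : ∀ x y → dist G x y ≡ dist G y x
    dist-sym x y = ≤-antisym (dist-sym≤ y x) (dist-sym≤ x y)

module EdgeLists where
  open import Data.Nat using (ℕ; zero; suc; _+_; _*_; _≤_; _<_; s≤s)
  open import Data.Nat.Properties
  open import Data.List using (List; []; _∷_; _++_; map; upTo; applyUpTo; length)
  open import Data.Nat.ListAction using (sum)
  open import Data.List.Membership.Propositional using (_∈_)
  open import Data.List.Membership.Propositional.Properties using (∈-map⁻; ∈-upTo⁻; ∈-++⁻)
  open import Data.List.Relation.Unary.Any using (here; there)
  open import Data.Product using (_×_; _,_; proj₁; proj₂)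
  open import Data.Sum using (inj₁; inj₂)
  open import Function using (_∘_)
  open import Relation.Binary.PropositionalEquality
  open import Algebra.Properties.CommutativeSemigroup +-commutativeSemigroup using (interchange)
  open FiniteSums
  open Distance

  ∑edges : (ℕ → ℕ → ℕ) → List (ℕ × ℕ) → ℕ
  ∑edges F es = sum (map (λ e → F (proj₁ e) (proj₂ e)) es)

  ∑edges-++ : ∀ F es fs → ∑edges F (es ++ fs) ≡ ∑edges F es + ∑edges F fs
  ∑edges-++ F []       fs = refl
  ∑edges-++ F (e ∷ es) fs rewrite ∑edges-++ F es fs = sym (+-assoc (F (proj₁ e) (proj₂ e)) (∑edges F es) (∑edges F fs))

  ∑edges-cong : ∀ F G es → (∀ p q → (p , q) ∈ es → F p q ≡ G p q) → ∑edges F es ≡ ∑edges G es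
  ∑edges-cong F G []             F≗G = refl
  ∑edges-cong F G ((p , q) ∷ es) F≗G =
    cong₂ _+_ (F≗G p q (here refl)) (∑edges-cong F G es (λ p′ q′ e∈ → F≗G p′ q′ (there e∈)))

  ∑edges-+ : ∀ F G es → ∑edges (λ p q → F p q + G p q) es ≡ ∑edges F es + ∑edges G es
  ∑edges-+ F G []             = refl
  ∑edges-+ F G ((p , q) ∷ es) rewrite ∑edges-+ F G es = interchange (F p q) (G p q) (∑edges F es) (∑edges G es)

  ∑edges-*ˡ : ∀ c F es → ∑edges (λ p q → c * F p q) es ≡ c * ∑edges F es
  ∑edges-*ˡ c F []             = sym (*-zeroʳ c)
  ∑edges-*ˡ c F ((p , q) ∷ es) rewrite ∑edges-*ˡ c F es = sym (*-distribˡ-+ c (F p q) (∑edges F es))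

  ∑edges-const : ∀ c es → ∑edges (λ _ _ → c) es ≡ length es * c
  ∑edges-const c []       = refl
  ∑edges-const c (e ∷ es) = cong (c +_) (∑edges-const c es)

  ∑edges-applyUpTo : ∀ F (e : ℕ → ℕ × ℕ) g n →
    ∑edges F (map e (applyUpTo g n)) ≡ ∑ (λ k → F (proj₁ (e (g k))) (proj₂ (e (g k)))) n
  ∑edges-applyUpTo F e g zero    = refl
  ∑edges-applyUpTo F e g (suc n) =
    trans (cong (F (proj₁ (e (g 0))) (proj₂ (e (g 0))) +_) (∑edges-applyUpTo F e (g ∘ suc) n)) (sym (∑-unfoldˡ _ n))

  AllEdges : (ℕ → ℕ → Set) → List (ℕ × ℕ) → Set
  AllEdges P es = ∀ p q → (p , q) ∈ es → P p q

  AllEdges-weaken : ∀ {P Q : ℕ → ℕ → Set} es → AllEdges P es → (∀ p q → P p q → Q p q) → AllEdges Q es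
  AllEdges-weaken es all P⇒Q p q pq∈ = P⇒Q p q (all p q pq∈)

  AllEdges-∷ : ∀ {P p q es} → P p q → AllEdges P es → AllEdges P ((p , q) ∷ es)
  AllEdges-∷ Ppq all p q (here refl)  = Ppq
  AllEdges-∷ Ppq all p q (there pq∈) = all p q pq∈

  AllEdges-++ : ∀ {P} es {fs} → AllEdges P es → AllEdges P fs → AllEdges P (es ++ fs)
  AllEdges-++ es allᵉ allᶠ p q pq∈ with ∈-++⁻ es pq∈
  ... | inj₁ pq∈es = allᵉ p q pq∈es
  ... | inj₂ pq∈fs = allᶠ p q pq∈fs

  AllEdges-upTo : ∀ {P} (e : ℕ → ℕ × ℕ) n → (∀ k → k < n → P (proj₁ (e k)) (proj₂ (e k))) →
    AllEdges P (map e (upTo n))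
  AllEdges-upTo {P} e n Pe p q pq∈ with ∈-map⁻ e pq∈
  ... | k , k∈ , refl = Pe k (∈-upTo⁻ k∈)

  EdgeLipschitz : (ℕ → ℕ) → ℕ → ℕ → Set
  EdgeLipschitz f p q = f q ≤ suc (f p) × f p ≤ suc (f q)

  EdgeLipschitz-cong : ∀ f g {p q} → f p ≡ g p → f q ≡ g q → EdgeLipschitz g p q → EdgeLipschitz f p q
  EdgeLipschitz-cong f g fp≡gp fq≡gq rewrite fp≡gp | fq≡gq = λ lip → lip

  EdgeLipschitz-at : ∀ f {p q x y} → f p ≡ x → f q ≡ y → y ≤ suc x → x ≤ suc y → EdgeLipschitz f p q
  EdgeLipschitz-at f refl refl y≤1+x x≤1+y = y≤1+x , x≤1+y

  EdgeLipschitz-suc : ∀ f {p q} → EdgeLipschitz f p q → EdgeLipschitz (λ z → suc (f z)) p q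
  EdgeLipschitz-suc f (le₁ , le₂) = s≤s le₁ , s≤s le₂

  AllEdges-EdgeLipschitz⇒Lipschitz : ∀ G f → AllEdges (EdgeLipschitz f) (edges G) → Lipschitz G f
  AllEdges-EdgeLipschitz⇒Lipschitz G f all x y e with adj⁻ G x y e
  ... | p , q , pq∈ , inj₁ (refl , refl) = proj₁ (all p q pq∈)
  ... | p , q , pq∈ , inj₂ (refl , refl) = proj₂ (all p q pq∈)

  dist-EdgeLipschitz : ∀ G → VerticesBounded G → ∀ x → AllEdges (EdgeLipschitz (dist G x)) (edges G)
  dist-EdgeLipschitz G bounded x p q pq∈ =
    ≤-trans (dist-triangle G x p q) (≤-trans (+-monoʳ-≤ (dist G x p) (dist-edge G bounded p q pq∈)) (≤-reflexive (+-comm _ 1))) ,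
    ≤-trans (dist-triangle G x q p) (≤-trans (+-monoʳ-≤ (dist G x q) qp≤1) (≤-reflexive (+-comm _ 1)))
    where
    qp≤1 : dist G q p ≤ 1
    qp≤1 = subst (_≤ 1) (dist-sym G bounded p q) (dist-edge G bounded p q pq∈)

module Handshake where
  open import Data.Nat using (ℕ; suc; _+_; _*_; _≤_; _<_; _≡ᵇ_)
  open import Data.Nat.Properties
  open import Data.Bool using (Bool; true; false; _∧_; _∨_; T?)
  open import Data.List using (List; []; _∷_; map; upTo; filter; length)
  open import Data.Nat.ListAction using (sum)
  open import Data.Bool.ListAction using (any)
  open import Data.List.Membership.Propositional using (_∈_)
  open import Data.List.Relation.Unary.Any using (here; there)
  open import Data.Product using (_×_; _,_; proj₁; proj₂)
  open import Data.Sum using (inj₁; inj₂)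
  open import Data.Empty using (⊥; ⊥-elim)
  open import Function using (_∘_)
  open import Relation.Binary.PropositionalEquality
  open import Data.Nat.Tactic.RingSolver using (solve-∀)
  open ≡-Reasoning
  open FiniteSums
  open EdgeLists
  open Distance using (≡ᵇ≡true⁻; ≡ᵇ-refl; ∧≡true⁻)

  𝟙 : Bool → ℕ
  𝟙 true  = 1
  𝟙 false = 0

  count : ∀ {A : Set} → (A → Bool) → List A → ℕ
  count f xs = sum (map (𝟙 ∘ f) xs)

  length-filter : ∀ (p : ℕ → Bool) xs → length (filter (λ y → T? (p y)) xs) ≡ count p xs
  length-filter p []       = refl
  length-filter p (x ∷ xs) with p x
  ... | true  = cong suc (length-filter p xs)
  ... | false = length-filter p xs

  deg≡∑ : ∀ G x → deg G x ≡ ∑ (λ y → 𝟙 (adj G x y)) (N G)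
  deg≡∑ G x = trans (length-filter (adj G x) (upTo (N G))) (sum-map-upTo (𝟙 ∘ adj G x) (N G))

  joinsᵇ : ℕ → ℕ → ℕ × ℕ → Bool
  joinsᵇ x y (p , q) = ((p ≡ᵇ x) ∧ (q ≡ᵇ y)) ∨ ((p ≡ᵇ y) ∧ (q ≡ᵇ x))

  adj-graph : ∀ n es x y → adj (graph n es) x y ≡ any (joinsᵇ x y) es
  adj-graph n []             x y = refl
  adj-graph n ((p , q) ∷ es) x y = cong (joinsᵇ x y (p , q) ∨_) (adj-graph n es x y)

  Loopless : List (ℕ × ℕ) → Set
  Loopless es = ∀ p q → (p , q) ∈ es → p ≢ q

  NoParallelEdges : List (ℕ × ℕ) → Set
  NoParallelEdges es = ∀ x y → count (joinsᵇ x y) es ≤ 1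

  𝟙-any : ∀ {A : Set} (f : A → Bool) xs → count f xs ≤ 1 → 𝟙 (any f xs) ≡ count f xs
  𝟙-any f []       _  = refl
  𝟙-any f (x ∷ xs) le with f x
  ... | true  = cong suc (sym (n≤0⇒n≡0 (≤-pred le)))
  ... | false = 𝟙-any f xs le

  𝟙-∧ : ∀ a b → 𝟙 (a ∧ b) ≡ 𝟙 a * 𝟙 b
  𝟙-∧ true  true  = refl
  𝟙-∧ true  false = refl
  𝟙-∧ false b     = refl

  𝟙-∨ : ∀ a b → (a ≡ true → b ≡ true → ⊥) → 𝟙 (a ∨ b) ≡ 𝟙 a + 𝟙 b
  𝟙-∨ true  true  excl = ⊥-elim (excl refl refl)
  𝟙-∨ true  false excl = refl
  𝟙-∨ false b     excl = refl

  𝟙-≢ : ∀ p x → p ≢ x → 𝟙 (p ≡ᵇ x) ≡ 0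
  𝟙-≢ p x p≢x with p ≡ᵇ x in eq
  ... | true  = ⊥-elim (p≢x (≡ᵇ≡true⁻ p x eq))
  ... | false = refl

  𝟙-joins : ∀ p q x y → p ≢ q →
    𝟙 (joinsᵇ x y (p , q)) ≡ 𝟙 (p ≡ᵇ x) * 𝟙 (q ≡ᵇ y) + 𝟙 (q ≡ᵇ x) * 𝟙 (p ≡ᵇ y)
  𝟙-joins p q x y p≢q = trans (𝟙-∨ _ _ excl)
    (cong₂ _+_ (𝟙-∧ (p ≡ᵇ x) (q ≡ᵇ y)) (trans (𝟙-∧ (p ≡ᵇ y) (q ≡ᵇ x)) (*-comm (𝟙 (p ≡ᵇ y)) (𝟙 (q ≡ᵇ x)))))
    where
    excl : (p ≡ᵇ x) ∧ (q ≡ᵇ y) ≡ true → (p ≡ᵇ y) ∧ (q ≡ᵇ x) ≡ true → ⊥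
    excl e₁ e₂ = p≢q (trans (≡ᵇ≡true⁻ p y (proj₁ (∧≡true⁻ _ _ e₂))) (sym (≡ᵇ≡true⁻ q y (proj₂ (∧≡true⁻ _ _ e₁)))))

  ∑-indicator : ∀ p (g : ℕ → ℕ) n → p < n → ∑ (λ x → 𝟙 (p ≡ᵇ x) * g x) n ≡ g p
  ∑-indicator p g (suc n) p<1+n with m≤n⇒m<n∨m≡n (≤-pred p<1+n)
  ... | inj₁ p<n rewrite ∑-indicator p g n p<n | 𝟙-≢ p n (<⇒≢ p<n) = +-identityʳ (g p)
  ... | inj₂ refl rewrite ∑-zero (λ x → 𝟙 (n ≡ᵇ x) * g x) n (λ k k<n → cong (_* g k) (𝟙-≢ n k (λ e → <⇒≢ k<n (sym e))))
                        | ≡ᵇ-refl n = +-identityʳ (g n)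

  sum-map-*ʳ : ∀ {A : Set} (g : A → ℕ) xs c → sum (map g xs) * c ≡ sum (map (λ x → g x * c) xs)
  sum-map-*ʳ g []       c = refl
  sum-map-*ʳ g (x ∷ xs) c = trans (*-distribʳ-+ c (g x) (sum (map g xs))) (cong (g x * c +_) (sum-map-*ʳ g xs c))

  ∑-endpoints : ∀ p q n (F : ℕ → ℕ) → p ≢ q → p < n → q < n →
    ∑ (λ x → ∑ (λ y → 𝟙 (joinsᵇ x y (p , q)) * F x) n) n ≡ F p + F q
  ∑-endpoints p q n F p≢q p<n q<n = begin
    ∑ (λ x → ∑ (λ y → 𝟙 (joinsᵇ x y (p , q)) * F x) n) n
      ≡⟨ ∑-cong n (λ x _ → ∑-cong n (λ y _ → trans (cong (_* F x) (𝟙-joins p q x y p≢q)) (*-distribʳ-+ (F x) (𝟙 (p ≡ᵇ x) * 𝟙 (q ≡ᵇ y)) _))) ⟩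
    ∑ (λ x → ∑ (λ y → 𝟙 (p ≡ᵇ x) * 𝟙 (q ≡ᵇ y) * F x + 𝟙 (q ≡ᵇ x) * 𝟙 (p ≡ᵇ y) * F x) n) n
      ≡⟨ ∑-cong n (λ x _ → trans (∑-+ _ _ n) (cong₂ _+_
           (trans (∑-cong n (λ y _ → reorder (𝟙 (p ≡ᵇ x)) (𝟙 (q ≡ᵇ y)) (F x))) (∑-indicator q _ n q<n))
           (trans (∑-cong n (λ y _ → reorder (𝟙 (q ≡ᵇ x)) (𝟙 (p ≡ᵇ y)) (F x))) (∑-indicator p _ n p<n)))) ⟩
    ∑ (λ x → 𝟙 (p ≡ᵇ x) * F x + 𝟙 (q ≡ᵇ x) * F x) n
      ≡⟨ ∑-+ _ _ n ⟩
    ∑ (λ x → 𝟙 (p ≡ᵇ x) * F x) n + ∑ (λ x → 𝟙 (q ≡ᵇ x) * F x) n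
      ≡⟨ cong₂ _+_ (∑-indicator p F n p<n) (∑-indicator q F n q<n) ⟩
    F p + F q ∎
    where
    reorder : ∀ a b c → a * b * c ≡ b * (a * c)
    reorder = solve-∀

  sum-cong : ∀ {A : Set} (g h : A → ℕ) xs → (∀ x → x ∈ xs → g x ≡ h x) → sum (map g xs) ≡ sum (map h xs)
  sum-cong g h []       g≗h = refl
  sum-cong g h (x ∷ xs) g≗h = cong₂ _+_ (g≗h x (here refl)) (sum-cong g h xs (λ z z∈ → g≗h z (there z∈)))

  handshake : ∀ n es (F : ℕ → ℕ) → Distance.VerticesBounded (graph n es) → Loopless es → NoParallelEdges es →
    ∑ (λ x → deg (graph n es) x * F x) n ≡ ∑edges (λ p q → F p + F q) es
  handshake n es F bounded loopless simple = begin
    ∑ (λ x → deg G x * F x) n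
      ≡⟨ ∑-cong n (λ x _ → trans (cong (_* F x) (deg≡∑ G x)) (∑-*ʳ _ n (F x))) ⟩
    ∑ (λ x → ∑ (λ y → 𝟙 (adj G x y) * F x) n) n
      ≡⟨ ∑-cong n (λ x _ → ∑-cong n (λ y _ → cong (λ v → 𝟙 v * F x) (adj-graph n es x y))) ⟩
    ∑ (λ x → ∑ (λ y → 𝟙 (any (joinsᵇ x y) es) * F x) n) n
      ≡⟨ ∑-cong n (λ x _ → ∑-cong n (λ y _ →
           trans (cong (_* F x) (𝟙-any (joinsᵇ x y) es (simple x y))) (sum-map-*ʳ (𝟙 ∘ joinsᵇ x y) es (F x)))) ⟩
    ∑ (λ x → ∑ (λ y → sum (map (λ e → 𝟙 (joinsᵇ x y e) * F x) es)) n) n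
      ≡⟨ ∑-cong n (λ x _ → ∑-swap-sum (λ y e → 𝟙 (joinsᵇ x y e) * F x) es n) ⟩
    ∑ (λ x → sum (map (λ e → ∑ (λ y → 𝟙 (joinsᵇ x y e) * F x) n) es)) n
      ≡⟨ ∑-swap-sum (λ x e → ∑ (λ y → 𝟙 (joinsᵇ x y e) * F x) n) es n ⟩
    sum (map (λ e → ∑ (λ x → ∑ (λ y → 𝟙 (joinsᵇ x y e) * F x) n) n) es)
      ≡⟨ sum-cong _ _ es (λ { (p , q) pq∈ →
           ∑-endpoints p q n F (loopless p q pq∈) (proj₁ (bounded p q pq∈)) (proj₂ (bounded p q pq∈)) }) ⟩
    ∑edges (λ p q → F p + F q) es ∎
    where
    G : Graph
    G = graph n es

module SimpleEdgeLists where
  open import Data.Nat using (ℕ; zero; suc; _+_; _≤_; _<_; z≤n; s≤s)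
  open import Data.Nat.Properties
  open import Data.Bool using (Bool; true; false)
  open import Data.List using (List; []; _∷_; _++_; map; upTo; applyUpTo)
  open import Data.Product using (_×_; _,_; proj₁; proj₂; ∃)
  open import Data.Sum using (_⊎_; inj₁; inj₂)
  open import Data.Empty using (⊥; ⊥-elim)
  open import Function using (_∘_)
  open import Relation.Binary.PropositionalEquality
  open FiniteSums
  open Distance using (Joins; ∨≡true⁻; ∧≡true⁻; ≡ᵇ≡true⁻)
  open Handshake using (𝟙; count; joinsᵇ)

  -- Z bounds where the edges of es lie, so that lists in disjoint regions concatenate to a simple list.
  record SimpleWithin (es : List (ℕ × ℕ)) (Z : ℕ → ℕ → Set) : Set where
    constructor simpleWithin
    field occurrences : ∀ x y → count (joinsᵇ x y) es ≤ 1 × (1 ≤ count (joinsᵇ x y) es → Z x y)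
  open SimpleWithin public

  count-++ : ∀ {A : Set} (f : A → Bool) xs ys → count f (xs ++ ys) ≡ count f xs + count f ys
  count-++ f []       ys = refl
  count-++ f (x ∷ xs) ys rewrite count-++ f xs ys = sym (+-assoc (𝟙 (f x)) _ _)

  count-applyUpTo : ∀ (f : ℕ × ℕ → Bool) (e : ℕ → ℕ × ℕ) g n →
    count f (map e (applyUpTo g n)) ≡ ∑ (λ k → 𝟙 (f (e (g k)))) n
  count-applyUpTo f e g zero    = refl
  count-applyUpTo f e g (suc n) =
    trans (cong (𝟙 (f (e (g 0))) +_) (count-applyUpTo f e (g ∘ suc) n)) (sym (∑-unfoldˡ _ n))

  joinsᵇ⇒Joins : ∀ p q x y → joinsᵇ x y (p , q) ≡ true → Joins p q x y
  joinsᵇ⇒Joins p q x y e with ∨≡true⁻ _ _ e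
  ... | inj₁ c = inj₁ (≡ᵇ≡true⁻ p x (proj₁ (∧≡true⁻ _ _ c)) , ≡ᵇ≡true⁻ q y (proj₂ (∧≡true⁻ _ _ c)))
  ... | inj₂ c = inj₂ (≡ᵇ≡true⁻ p y (proj₁ (∧≡true⁻ _ _ c)) , ≡ᵇ≡true⁻ q x (proj₂ (∧≡true⁻ _ _ c)))

  SimpleWithin-weaken : ∀ {es Z Z′} → SimpleWithin es Z → (∀ x y → Z x y → Z′ x y) → SimpleWithin es Z′
  SimpleWithin-weaken (simpleWithin occ) Z⇒Z′ =
    simpleWithin λ x y → proj₁ (occ x y) , λ once → Z⇒Z′ x y (proj₂ (occ x y) once)

  SimpleWithin-[] : ∀ {Z} → SimpleWithin [] Z
  SimpleWithin-[] = simpleWithin λ x y → z≤n , λ ()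

  SimpleWithin-++ : ∀ {Z₁ Z₂} es fs → SimpleWithin es Z₁ → SimpleWithin fs Z₂ → (∀ x y → Z₁ x y → Z₂ x y → ⊥) →
    SimpleWithin (es ++ fs) (λ x y → Z₁ x y ⊎ Z₂ x y)
  SimpleWithin-++ {Z₁} {Z₂} es fs (simpleWithin occ₁) (simpleWithin occ₂) disjoint = simpleWithin occ
    where
    occ : ∀ x y → count (joinsᵇ x y) (es ++ fs) ≤ 1 × (1 ≤ count (joinsᵇ x y) (es ++ fs) → Z₁ x y ⊎ Z₂ x y)
    occ x y rewrite count-++ (joinsᵇ x y) es fs
      with count (joinsᵇ x y) es | proj₁ (occ₁ x y) | proj₂ (occ₁ x y)
         | count (joinsᵇ x y) fs | proj₁ (occ₂ x y) | proj₂ (occ₂ x y)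
    ... | zero        | _      | _  | _      | c₂≤1 | z₂ = c₂≤1 , λ once → inj₂ (z₂ once)
    ... | suc zero    | _      | z₁ | zero   | _    | _  = s≤s z≤n , λ _ → inj₁ (z₁ (s≤s z≤n))
    ... | suc zero    | _      | z₁ | suc _  | _    | z₂ = ⊥-elim (disjoint x y (z₁ (s≤s z≤n)) (z₂ (s≤s z≤n)))
    ... | suc (suc _) | s≤s () | _  | _      | _    | _

  SimpleWithin-single : ∀ p q → SimpleWithin ((p , q) ∷ []) (Joins p q)
  SimpleWithin-single p q = simpleWithin occ
    where
    occ : ∀ x y → count (joinsᵇ x y) ((p , q) ∷ []) ≤ 1 × (1 ≤ count (joinsᵇ x y) ((p , q) ∷ []) → Joins p q x y)
    occ x y with joinsᵇ x y (p , q) in e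
    ... | true  = s≤s z≤n , λ _ → joinsᵇ⇒Joins p q x y e
    ... | false = z≤n , λ ()

  ∑-at-most-one : ∀ (P : ℕ → Bool) n → (∀ k k′ → k < n → k′ < n → P k ≡ true → P k′ ≡ true → k ≡ k′) →
    ∑ (𝟙 ∘ P) n ≤ 1 × (1 ≤ ∑ (𝟙 ∘ P) n → ∃ λ k → k < n × P k ≡ true)
  ∑-at-most-one P zero    unique = z≤n , λ ()
  ∑-at-most-one P (suc n) unique with P n in Pn
  ... | true  = ≤-reflexive (trans (+-comm _ 1) (cong suc (∑-zero (𝟙 ∘ P) n none-below))) , λ _ → n , ≤-refl , Pn
    where
    none-below : ∀ k → k < n → 𝟙 (P k) ≡ 0
    none-below k k<n with P k in Pk
    ... | true  = ⊥-elim (<⇒≢ k<n (unique k n (m<n⇒m<1+n k<n) ≤-refl Pk Pn))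
    ... | false = refl
  ... | false with ∑-at-most-one P n (λ k k′ k<n k′<n → unique k k′ (m<n⇒m<1+n k<n) (m<n⇒m<1+n k′<n))
  ... | ≤1 , witness = ≤-trans (≤-reflexive (+-identityʳ _)) ≤1 ,
        λ once → let k , k<n , Pk = witness (≤-trans once (≤-reflexive (+-identityʳ _))) in k , m<n⇒m<1+n k<n , Pk

  SimpleWithin-upTo : ∀ (e : ℕ → ℕ × ℕ) n →
    (∀ k k′ x y → k < n → k′ < n → Joins (proj₁ (e k)) (proj₂ (e k)) x y → Joins (proj₁ (e k′)) (proj₂ (e k′)) x y → k ≡ k′) →
    SimpleWithin (map e (upTo n)) (λ x y → ∃ λ k → k < n × Joins (proj₁ (e k)) (proj₂ (e k)) x y)
  SimpleWithin-upTo e n injective = simpleWithin occ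
    where
    occ : ∀ x y → count (joinsᵇ x y) (map e (upTo n)) ≤ 1 ×
                  (1 ≤ count (joinsᵇ x y) (map e (upTo n)) → ∃ λ k → k < n × Joins (proj₁ (e k)) (proj₂ (e k)) x y)
    occ x y rewrite count-applyUpTo (joinsᵇ x y) e (λ z → z) n
      with ∑-at-most-one (λ k → joinsᵇ x y (e k)) n
             (λ k k′ k<n k′<n jk jk′ → injective k k′ x y k<n k′<n (joinsᵇ⇒Joins _ _ x y jk) (joinsᵇ⇒Joins _ _ x y jk′))
    ... | ≤1 , witness = ≤1 , λ once → let k , k<n , jk = witness once in k , k<n , joinsᵇ⇒Joins _ _ x y jk

  Band : ℕ → ℕ → ℕ → ℕ → Set
  Band lo hi x y = (lo ≤ x ⊎ lo ≤ y) × x < hi × y < hi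

  Band-disjoint : ∀ l₁ h₁ l₂ h₂ → h₁ ≤ l₂ → ∀ x y → Band l₁ h₁ x y → Band l₂ h₂ x y → ⊥
  Band-disjoint l₁ h₁ l₂ h₂ h₁≤l₂ x y (_ , x<h₁ , y<h₁) (inj₁ l₂≤x , _) = <⇒≱ x<h₁ (≤-trans h₁≤l₂ l₂≤x)
  Band-disjoint l₁ h₁ l₂ h₂ h₁≤l₂ x y (_ , x<h₁ , y<h₁) (inj₂ l₂≤y , _) = <⇒≱ y<h₁ (≤-trans h₁≤l₂ l₂≤y)

  Band-join : ∀ l₁ h₁ h₂ → l₁ ≤ h₁ → h₁ ≤ h₂ → ∀ x y → Band l₁ h₁ x y ⊎ Band h₁ h₂ x y → Band l₁ h₂ x y
  Band-join l₁ h₁ h₂ l₁≤h₁ h₁≤h₂ x y (inj₁ (lo , x< , y<))       = lo , <-≤-trans x< h₁≤h₂ , <-≤-trans y< h₁≤h₂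
  Band-join l₁ h₁ h₂ l₁≤h₁ h₁≤h₂ x y (inj₂ (inj₁ lo , x< , y<)) = inj₁ (≤-trans l₁≤h₁ lo) , x< , y<
  Band-join l₁ h₁ h₂ l₁≤h₁ h₁≤h₂ x y (inj₂ (inj₂ lo , x< , y<)) = inj₂ (≤-trans l₁≤h₁ lo) , x< , y<

  Joins⇒Band : ∀ p q lo hi x y → (lo ≤ p ⊎ lo ≤ q) → p < hi → q < hi → Joins p q x y → Band lo hi x y
  Joins⇒Band p q lo hi x y lo≤       p< q< (inj₁ (refl , refl)) = lo≤ , p< , q<
  Joins⇒Band p q lo hi x y (inj₁ lo≤) p< q< (inj₂ (refl , refl)) = inj₂ lo≤ , q< , p<
  Joins⇒Band p q lo hi x y (inj₂ lo≤) p< q< (inj₂ (refl , refl)) = inj₁ lo≤ , q< , p<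

module CyclePathPendantEdges where
  open import Data.Nat using (ℕ; zero; suc; _+_; _*_; _∸_; _≤_; _<_; z≤n; s≤s)
  open import Data.Nat.Properties
  open import Data.List using (List; []; _∷_; map; upTo; length)
  open import Data.List.Properties using (length-map; length-upTo)
  open import Data.List.Membership.Propositional using (_∈_)
  open import Data.List.Membership.Propositional.Properties using (∈-map⁺; ∈-upTo⁺)
  open import Data.List.Relation.Unary.Any using (here; there)
  open import Data.Product using (_×_; _,_; ∃)
  open import Data.Sum using (inj₁; inj₂)
  open import Data.Empty using (⊥; ⊥-elim)
  open import Relation.Binary.PropositionalEquality
  open import Data.Nat.Tactic.RingSolver using (solve-∀)
  open ≡-Reasoning
  open FiniteSums
  open Distance using (Joins)
  open EdgeLists using (AllEdges; AllEdges-∷; AllEdges-upTo; ∑edges; ∑edges-applyUpTo)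
  open SimpleEdgeLists

  EdgeWithin : ℕ → ℕ → ℕ → Set
  EdgeWithin n p q = p < n × q < n × p ≢ q

  n≢1+n : ∀ {n} → n ≢ suc n
  n≢1+n ()

  n≢2+n : ∀ n → n ≢ suc (suc n)
  n≢2+n zero    ()
  n≢2+n (suc n) e = n≢2+n n (suc-injective e)

  consecutive-injective : ∀ s k k′ x y → Joins (s + k) (s + suc k) x y → Joins (s + k′) (s + suc k′) x y → k ≡ k′
  consecutive-injective s k k′ x y (inj₁ (refl , refl)) (inj₁ (e , _)) = +-cancelˡ-≡ s k k′ (sym e)
  consecutive-injective s k k′ x y (inj₂ (refl , refl)) (inj₂ (e , _)) = +-cancelˡ-≡ s k k′ (sym e)
  consecutive-injective s k k′ x y (inj₁ (refl , refl)) (inj₂ (e₁ , e₂)) =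
    ⊥-elim (n≢2+n k (trans (sym (+-cancelˡ-≡ s (suc k′) k e₂)) (cong suc (+-cancelˡ-≡ s k′ (suc k) e₁))))
  consecutive-injective s k k′ x y (inj₂ (refl , refl)) (inj₁ (e₁ , e₂)) =
    ⊥-elim (n≢2+n k (trans (sym (+-cancelˡ-≡ s (suc k′) k e₂)) (cong suc (+-cancelˡ-≡ s k′ (suc k) e₁))))

  cycleEdges-within : ∀ m → 3 ≤ m → AllEdges (EdgeWithin m) (cycleEdges m)
  cycleEdges-within (suc (suc (suc m))) (s≤s (s≤s (s≤s _))) =
    AllEdges-∷ (≤-refl , s≤s z≤n , λ ()) (AllEdges-upTo (λ k → (k , suc k)) (suc (suc m))
      (λ k k< → m<n⇒m<1+n k< , s≤s k< , n≢1+n))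

  cycleEdges-simple : ∀ m → 3 ≤ m → SimpleWithin (cycleEdges m) (Band 0 m)
  cycleEdges-simple (suc (suc (suc m))) (s≤s (s≤s (s≤s _))) = SimpleWithin-weaken
    (SimpleWithin-++ ((2+m , 0) ∷ []) (map (λ k → (k , suc k)) (upTo 2+m)) (SimpleWithin-single 2+m 0)
      (SimpleWithin-upTo (λ k → (k , suc k)) 2+m (λ k k′ x y _ _ → consecutive-injective 0 k k′ x y)) disjoint)
    λ { x y (inj₁ j)              → Joins⇒Band 2+m 0 0 (suc 2+m) x y (inj₁ z≤n) ≤-refl (s≤s z≤n) j
      ; x y (inj₂ (k , k< , j)) → Joins⇒Band k (suc k) 0 (suc 2+m) x y (inj₁ z≤n) (m<n⇒m<1+n k<) (s≤s k<) j }
    where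
    2+m : ℕ
    2+m = suc (suc m)
    disjoint : ∀ x y → Joins 2+m 0 x y → (∃ λ k → k < 2+m × Joins k (suc k) x y) → ⊥
    disjoint x y (inj₁ (refl , refl)) (k , k< , inj₁ (_ , ()))
    disjoint x y (inj₁ (refl , refl)) (k , k< , inj₂ (refl , e)) with suc-injective e
    ... | ()
    disjoint x y (inj₂ (refl , refl)) (k , k< , inj₁ (refl , e)) with suc-injective e
    ... | ()
    disjoint x y (inj₂ (refl , refl)) (k , k< , inj₂ (_ , ()))

  pathEdges-within : ∀ w s len → w < s → AllEdges (EdgeWithin (s + len)) (pathEdges w s len)
  pathEdges-within w s zero      w<s = λ _ _ ()
  pathEdges-within w s (suc len) w<s =
    AllEdges-∷ (<-≤-trans w<s (m≤m+n s (suc len)) , m<m+n s (s≤s z≤n) , <⇒≢ w<s)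
      (AllEdges-upTo (λ k → (s + k , s + suc k)) len (λ k k< →
         +-monoʳ-< s (m<n⇒m<1+n k<) , +-monoʳ-< s (s≤s k<) , λ e → n≢1+n (+-cancelˡ-≡ s k (suc k) e)))

  pathEdges-simple : ∀ w s len → w < s → SimpleWithin (pathEdges w s len) (Band s (s + len))
  pathEdges-simple w s zero      w<s = SimpleWithin-[]
  pathEdges-simple w s (suc len) w<s = SimpleWithin-weaken
    (SimpleWithin-++ ((w , s) ∷ []) (map (λ k → (s + k , s + suc k)) (upTo len)) (SimpleWithin-single w s)
      (SimpleWithin-upTo (λ k → (s + k , s + suc k)) len (λ k k′ x y _ _ → consecutive-injective s k k′ x y)) disjoint)
    λ { x y (inj₁ j) → Joins⇒Band w s s (s + suc len) x y (inj₂ ≤-refl) (<-≤-trans w<s (m≤m+n s (suc len))) (m<m+n s (s≤s z≤n)) j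
      ; x y (inj₂ (k , k< , j)) → Joins⇒Band (s + k) (s + suc k) s (s + suc len) x y (inj₁ (m≤m+n s k))
                                     (+-monoʳ-< s (m<n⇒m<1+n k<)) (+-monoʳ-< s (s≤s k<)) j }
    where
    w≢s+ : ∀ k → w ≢ s + k
    w≢s+ k e = <⇒≱ w<s (≤-trans (m≤m+n s k) (≤-reflexive (sym e)))
    disjoint : ∀ x y → Joins w s x y → (∃ λ k → k < len × Joins (s + k) (s + suc k) x y) → ⊥
    disjoint x y (inj₁ (refl , refl)) (k , _ , inj₁ (e , _)) = w≢s+ k (sym e)
    disjoint x y (inj₁ (refl , refl)) (k , _ , inj₂ (_ , e)) = w≢s+ (suc k) (sym e)
    disjoint x y (inj₂ (refl , refl)) (k , _ , inj₁ (_ , e)) = w≢s+ (suc k) (sym e)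
    disjoint x y (inj₂ (refl , refl)) (k , _ , inj₂ (e , _)) = w≢s+ k (sym e)

  pendantEdges-within : ∀ w n h → w < n → AllEdges (EdgeWithin (n + h)) (pendantEdges w n h)
  pendantEdges-within w n h w<n = AllEdges-upTo (λ k → (w , n + k)) h (λ k k< →
    <-≤-trans w<n (m≤m+n n h) , +-monoʳ-< n k< , λ e → <⇒≱ w<n (≤-trans (m≤m+n n k) (≤-reflexive (sym e))))

  pendantEdges-simple : ∀ w n h → w < n → SimpleWithin (pendantEdges w n h) (Band n (n + h))
  pendantEdges-simple w n h w<n = SimpleWithin-weaken (SimpleWithin-upTo (λ k → (w , n + k)) h injective)
    λ { x y (k , k< , j) → Joins⇒Band w (n + k) n (n + h) x y (inj₂ (m≤m+n n k)) (<-≤-trans w<n (m≤m+n n h)) (+-monoʳ-< n k<) j }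
    where
    w≢n+ : ∀ k → w ≢ n + k
    w≢n+ k e = <⇒≱ w<n (≤-trans (m≤m+n n k) (≤-reflexive (sym e)))
    injective : ∀ k k′ x y → k < h → k′ < h → Joins w (n + k) x y → Joins w (n + k′) x y → k ≡ k′
    injective k k′ x y _ _ (inj₁ (refl , refl)) (inj₁ (_ , e)) = +-cancelˡ-≡ n k k′ (sym e)
    injective k k′ x y _ _ (inj₂ (refl , refl)) (inj₂ (_ , e)) = +-cancelˡ-≡ n k k′ (sym e)
    injective k k′ x y _ _ (inj₁ (refl , refl)) (inj₂ (e , _)) = ⊥-elim (w≢n+ k e)
    injective k k′ x y _ _ (inj₂ (refl , refl)) (inj₁ (e , _)) = ⊥-elim (w≢n+ k e)

  cycleEdges-∋ : ∀ m k → suc k < m → (k , suc k) ∈ cycleEdges m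
  cycleEdges-∋ (suc m) k (s≤s k<) = there (∈-map⁺ (λ k → (k , suc k)) (∈-upTo⁺ k<))

  pathEdges-∋ : ∀ w s len k → suc k < len → (s + k , s + suc k) ∈ pathEdges w s len
  pathEdges-∋ w s (suc len) k (s≤s k<) = there (∈-map⁺ (λ k → (s + k , s + suc k)) (∈-upTo⁺ k<))

  pathEdges-∋-first : ∀ w s len → 1 ≤ len → (w , s) ∈ pathEdges w s len
  pathEdges-∋-first w s (suc len) _ = here refl

  pendantEdges-∋ : ∀ w n h k → k < h → (w , n + k) ∈ pendantEdges w n h
  pendantEdges-∋ w n h k k< = ∈-map⁺ (λ k → (w , n + k)) (∈-upTo⁺ k<)

  AllEdges-pathEdges : ∀ {P} w s len → (1 ≤ len → P w s) → (∀ k → suc k < len → P (s + k) (s + suc k)) →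
    AllEdges P (pathEdges w s len)
  AllEdges-pathEdges w s zero      first step = λ _ _ ()
  AllEdges-pathEdges w s (suc len) first step =
    AllEdges-∷ (first (s≤s z≤n)) (AllEdges-upTo (λ k → (s + k , s + suc k)) len (λ k k< → step k (s≤s k<)))

  ∑edges-pathEdges-telescope : ∀ (f : ℕ → ℕ) w s n → 1 ≤ n →
    ∑edges (λ p q → f p + f q) (pathEdges w s n) + f (s + (n ∸ 1)) ≡ f w + 2 * ∑ (λ k → f (s + k)) n
  ∑edges-pathEdges-telescope f w s (suc n) _ = begin
    f w + f s + ∑edges F (map (λ k → (s + k , s + suc k)) (upTo n)) + f (s + n)
      ≡⟨ cong₂ (λ u v → f w + f u + v + f (s + n)) (sym (+-identityʳ s))
               (∑edges-applyUpTo F (λ k → (s + k , s + suc k)) (λ k → k) n) ⟩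
    f w + f (s + 0) + ∑ (λ k → f (s + k) + f (s + suc k)) n + f (s + n)
      ≡⟨ regroup (f w) (f (s + 0)) (∑ (λ k → f (s + k) + f (s + suc k)) n) (f (s + n)) ⟩
    f w + (∑ (λ k → f (s + k) + f (s + suc k)) n + f (s + 0) + f (s + n))
      ≡⟨ cong (f w +_) (∑-telescope (λ k → f (s + k)) n) ⟩
    f w + 2 * ∑ (λ k → f (s + k)) (suc n) ∎
    where
    F : ℕ → ℕ → ℕ
    F p q = f p + f q
    regroup : ∀ A x Y z → A + x + Y + z ≡ A + (Y + x + z)
    regroup = solve-∀

  length-cycleEdges : ∀ m → 1 ≤ m → length (cycleEdges m) ≡ m
  length-cycleEdges (suc m) _ = cong suc (trans (length-map _ (upTo m)) (length-upTo m))

  length-pathEdges : ∀ w s len → length (pathEdges w s len) ≡ len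
  length-pathEdges w s zero      = refl
  length-pathEdges w s (suc len) = cong suc (trans (length-map _ (upTo len)) (length-upTo len))


module PendantGraphs (m i j a b h : ℕ) (3≤m : 3 ≤ m) (i<m : i < m) (j<m : j < m) (1≤a : 1 ≤ a) (1≤b : 1 ≤ b) where
  open import Data.Nat using (ℕ; zero; suc; _+_; _*_; _∸_; _⊔_; _≤_; _<_; z≤n; s≤s; _<ᵇ_; _≡ᵇ_; ∣_-_∣)
  open import Data.Nat.Properties
  open import Data.Bool using (true; false; if_then_else_; T)
  open import Data.List using (List; _++_; length)
  open import Data.List.Membership.Propositional using (_∈_)
  open import Data.List.Membership.Propositional.Properties using (∈-++⁺ˡ; ∈-++⁺ʳ; ∈-++⁻)
  open import Data.Product using (_×_; _,_; proj₁; proj₂; ∃)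
  open import Data.Sum using (_⊎_; inj₁; inj₂)
  open import Data.Empty using (⊥-elim)
  open import Relation.Nullary using (yes; no)
  open import Relation.Binary.PropositionalEquality
  open import Data.Nat.Tactic.RingSolver using (solve-∀)
  open FiniteSums
  open Distance
  open EdgeLists
  open Handshake using (Loopless; NoParallelEdges; handshake)
  open SimpleEdgeLists
  open CyclePathPendantEdges

  n₀ N₀ : ℕ
  n₀ = m + a + b
  N₀ = n₀ + h

  Es : List (ℕ × ℕ)
  Es = GstarEdges m i j a b

  Gpend : ℕ → Graph
  Gpend w = graph N₀ (Es ++ pendantEdges w n₀ h)

  -- pb 0 = v_j and pb k = u_k; likewise pa 0 = v_i followed by the vertices of P_a.
  pb pa : ℕ → ℕ
  pb zero    = j
  pb (suc k) = m + a + k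
  pa zero    = i
  pa (suc k) = m + k

  m≤m+a : m ≤ m + a
  m≤m+a = m≤m+n m a

  m+a≤n₀ : m + a ≤ n₀
  m+a≤n₀ = m≤m+n (m + a) b

  n₀≤N₀ : n₀ ≤ N₀
  n₀≤N₀ = m≤m+n n₀ h

  j<m+a : j < m + a
  j<m+a = <-≤-trans j<m m≤m+a

  pb<n₀ : ∀ t → t ≤ b → pb t < n₀
  pb<n₀ zero    _   = <-≤-trans j<m+a m+a≤n₀
  pb<n₀ (suc t) t<b = +-monoʳ-< (m + a) t<b

  suc[m∸1]≡m : suc (m ∸ 1) ≡ m
  suc[m∸1]≡m = m+[n∸m]≡n (≤-trans (s≤s z≤n) 3≤m)

  CoreEdge : ℕ → ℕ → Set
  CoreEdge p q = p < m + a × q < m + a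

  cycleEdges-core : AllEdges CoreEdge (cycleEdges m)
  cycleEdges-core p q pq∈ with cycleEdges-within m 3≤m p q pq∈
  ... | p<m , q<m , _ = <-≤-trans p<m m≤m+a , <-≤-trans q<m m≤m+a

  pathEdges-i-core : AllEdges CoreEdge (pathEdges i m a)
  pathEdges-i-core p q pq∈ with pathEdges-within i m a i<m p q pq∈
  ... | p< , q< , _ = p< , q<

  Es-within : AllEdges (EdgeWithin n₀) Es
  Es-within = AllEdges-++ (cycleEdges m)
    (AllEdges-weaken (cycleEdges m) (cycleEdges-within m 3≤m)
      λ p q (p< , q< , p≢q) → <-≤-trans p< (≤-trans m≤m+a m+a≤n₀) , <-≤-trans q< (≤-trans m≤m+a m+a≤n₀) , p≢q)
    (AllEdges-++ (pathEdges i m a)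
      (AllEdges-weaken (pathEdges i m a) (pathEdges-within i m a i<m)
        λ p q (p< , q< , p≢q) → <-≤-trans p< m+a≤n₀ , <-≤-trans q< m+a≤n₀ , p≢q)
      (pathEdges-within j (m + a) b j<m+a))

  Es-simple : SimpleWithin Es (Band 0 n₀)
  Es-simple = SimpleWithin-weaken
    (SimpleWithin-++ (cycleEdges m) (pathEdges i m a ++ pathEdges j (m + a) b) (cycleEdges-simple m 3≤m)
      (SimpleWithin-weaken
        (SimpleWithin-++ (pathEdges i m a) (pathEdges j (m + a) b) (pathEdges-simple i m a i<m) (pathEdges-simple j (m + a) b j<m+a)
          (Band-disjoint m (m + a) (m + a) n₀ ≤-refl))
        (Band-join m (m + a) n₀ m≤m+a m+a≤n₀))
      (Band-disjoint 0 m m n₀ ≤-refl))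
    (Band-join 0 m n₀ z≤n (≤-trans m≤m+a m+a≤n₀))

  coreEdges⊆Es : ∀ {e} → e ∈ cycleEdges m ++ pathEdges i m a → e ∈ Es
  coreEdges⊆Es e∈ with ∈-++⁻ (cycleEdges m) e∈
  ... | inj₁ e∈C = ∈-++⁺ˡ e∈C
  ... | inj₂ e∈P = ∈-++⁺ʳ (cycleEdges m) (∈-++⁺ˡ e∈P)

  AllEdges-Es : ∀ {P} → AllEdges (λ p q → CoreEdge p q → P p q) (cycleEdges m ++ pathEdges i m a) →
    (1 ≤ b → P j (m + a)) → (∀ k → suc k < b → P (m + a + k) (m + a + suc k)) → AllEdges P Es
  AllEdges-Es core first step = AllEdges-++ (cycleEdges m)
    (λ p q pq∈ → core p q (∈-++⁺ˡ pq∈) (cycleEdges-core p q pq∈))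
    (AllEdges-++ (pathEdges i m a)
      (λ p q pq∈ → core p q (∈-++⁺ʳ (cycleEdges m) pq∈) (pathEdges-i-core p q pq∈))
      (AllEdges-pathEdges j (m + a) b first step))

  <ᵇ≡true : ∀ {x n} → x < n → (x <ᵇ n) ≡ true
  <ᵇ≡true {x} {n} x<n with x <ᵇ n in e
  ... | true  = refl
  ... | false = ⊥-elim (subst T e (<⇒<ᵇ x<n))

  <ᵇ≡false : ∀ {x n} → n ≤ x → (x <ᵇ n) ≡ false
  <ᵇ≡false {x} {n} n≤x with x <ᵇ n in e
  ... | false = refl
  ... | true  = ⊥-elim (<⇒≱ (<ᵇ⇒< x n (subst T (sym e) _)) n≤x)

  vertex-cases : ∀ y → y < N₀ →
    y < m + a ⊎ (∃ λ k → k < b × y ≡ m + a + k) ⊎ (∃ λ k → k < h × y ≡ n₀ + k)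
  vertex-cases y y<N₀ with y <? m + a | y <? n₀
  ... | yes y<m+a | _      = inj₁ y<m+a
  ... | no  y≮m+a | yes y<n₀ = inj₂ (inj₁ (offset (≮⇒≥ y≮m+a) y<n₀))
    where
    offset : ∀ {c n} → c ≤ y → y < c + n → ∃ λ k → k < n × y ≡ c + k
    offset {c} c≤y y< = y ∸ c , +-cancelˡ-< c _ _ (subst (_< _) (sym (m+[n∸m]≡n c≤y)) y<) , sym (m+[n∸m]≡n c≤y)
  ... | no  _     | no y≮n₀ = inj₂ (inj₂ (y ∸ n₀ ,
        +-cancelˡ-< n₀ _ _ (subst (_< N₀) (sym (m+[n∸m]≡n (≮⇒≥ y≮n₀))) y<N₀) , sym (m+[n∸m]≡n (≮⇒≥ y≮n₀))))

  module AtVertex (w : ℕ) (w<n₀ : w < n₀) where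

    G : Graph
    G = Gpend w

    d : ℕ → ℕ → ℕ
    d = dist G

    edges-within : AllEdges (EdgeWithin N₀) (edges G)
    edges-within = AllEdges-++ Es
      (AllEdges-weaken Es Es-within λ p q (p< , q< , p≢q) → <-≤-trans p< n₀≤N₀ , <-≤-trans q< n₀≤N₀ , p≢q)
      (pendantEdges-within w n₀ h w<n₀)

    bounded : VerticesBounded G
    bounded p q pq∈ = proj₁ (edges-within p q pq∈) , proj₁ (proj₂ (edges-within p q pq∈))

    loopless : Loopless (edges G)
    loopless p q pq∈ = proj₂ (proj₂ (edges-within p q pq∈))

    noParallelEdges : NoParallelEdges (edges G)
    noParallelEdges x y = proj₁ (occurrences simple x y)
      where
      simple : SimpleWithin (edges G) _
      simple = SimpleWithin-++ Es (pendantEdges w n₀ h) Es-simple (pendantEdges-simple w n₀ h w<n₀)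
                 (Band-disjoint 0 n₀ n₀ N₀ ≤-refl)

    D′≡∑edges : D′ G ≡ ∑edges (λ p q → D G p + D G q) (edges G)
    D′≡∑edges = trans (sum-map-upTo (λ x → deg G x * D G x) N₀)
                      (handshake N₀ (edges G) (D G) bounded loopless noParallelEdges)

    d-sym : ∀ x y → d x y ≡ d y x
    d-sym = dist-sym G bounded

    edge⇒d≤1 : ∀ {p q} → (p , q) ∈ edges G → d p q ≤ 1
    edge⇒d≤1 = dist-edge G bounded _ _

    Es⊆ : ∀ {e} → e ∈ Es → e ∈ edges G
    Es⊆ = ∈-++⁺ˡ

    pendantEdges⊆ : ∀ {e} → e ∈ pendantEdges w n₀ h → e ∈ edges G
    pendantEdges⊆ = ∈-++⁺ʳ Es

    pb-step : ∀ s → s < b → d (pb s) (pb (suc s)) ≤ 1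
    pb-step zero    0<b = subst (λ v → d j v ≤ 1) (sym (+-identityʳ (m + a)))
      (edge⇒d≤1 (Es⊆ (∈-++⁺ʳ (cycleEdges m) (∈-++⁺ʳ (pathEdges i m a) (pathEdges-∋-first j (m + a) b 0<b)))))
    pb-step (suc s) s<b =
      edge⇒d≤1 (Es⊆ (∈-++⁺ʳ (cycleEdges m) (∈-++⁺ʳ (pathEdges i m a) (pathEdges-∋ j (m + a) b s s<b))))

    pa-step : ∀ s → s < a → d (pa s) (pa (suc s)) ≤ 1
    pa-step zero    0<a = subst (λ v → d i v ≤ 1) (sym (+-identityʳ m))
      (edge⇒d≤1 (Es⊆ (∈-++⁺ʳ (cycleEdges m) (∈-++⁺ˡ (pathEdges-∋-first i m a 0<a)))))
    pa-step (suc s) s<a = edge⇒d≤1 (Es⊆ (∈-++⁺ʳ (cycleEdges m) (∈-++⁺ˡ (pathEdges-∋ i m a s s<a))))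

    cycle-step : ∀ s → s < m ∸ 1 → d s (suc s) ≤ 1
    cycle-step s s< = edge⇒d≤1 (Es⊆ (∈-++⁺ˡ (cycleEdges-∋ m s (subst (suc s <_) suc[m∸1]≡m (s≤s s<)))))

    d-pb≤ : ∀ k l → k ≤ l → l ≤ b → d (pb k) (pb l) ≤ l ∸ k
    d-pb≤ k l k≤l l≤b = subst (λ v → d (pb k) (pb v) ≤ l ∸ k) (m+[n∸m]≡n k≤l)
      (dist-chain G pb b pb-step k (l ∸ k) (subst (_≤ b) (sym (m+[n∸m]≡n k≤l)) l≤b))

    d-cycle≤ : ∀ x y → x ≤ y → y < m → d x y ≤ y ∸ x
    d-cycle≤ x y x≤y y<m = subst (λ v → d x v ≤ y ∸ x) (m+[n∸m]≡n x≤y)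
      (dist-chain G (λ z → z) (m ∸ 1) cycle-step x (y ∸ x)
        (subst (_≤ m ∸ 1) (sym (m+[n∸m]≡n x≤y)) (≤-pred (subst (y <_) (sym suc[m∸1]≡m) y<m))))

    d-cycle : ∀ x y → x < m → y < m → d x y < m
    d-cycle x y x<m y<m with ≤-total x y
    ... | inj₁ x≤y = ≤-<-trans (d-cycle≤ x y x≤y y<m) (≤-<-trans (m∸n≤m y x) y<m)
    ... | inj₂ y≤x = subst (_< m) (d-sym y x) (≤-<-trans (d-cycle≤ y x y≤x x<m) (≤-<-trans (m∸n≤m x y) x<m))

    d-i-pa : ∀ s → s < a → d i (m + s) ≤ suc s
    d-i-pa s s<a = dist-chain G pa a pa-step 0 (suc s) s<a

    d-j-core : ∀ x → x < m + a → d j x < m + a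
    d-j-core x x<m+a with x <? m
    ... | yes x<m = <-≤-trans (d-cycle j x j<m x<m) m≤m+a
    ... | no  x≮m = subst (λ v → d j v < m + a) (m+[n∸m]≡n m≤x)
          (≤-<-trans (dist-triangle G j i (m + s)) (<-≤-trans (+-mono-<-≤ (d-cycle j i j<m i<m) (d-i-pa s s<a)) (+-monoʳ-≤ m s<a)))
      where
      m≤x : m ≤ x
      m≤x = ≮⇒≥ x≮m
      s : ℕ
      s = x ∸ m
      s<a : s < a
      s<a = +-cancelˡ-< m s a (subst (_< m + a) (sym (m+[n∸m]≡n m≤x)) x<m+a)

    extend : (ℕ → ℕ) → ℕ → ℕ
    extend g z = if z <ᵇ n₀ then g z else g w

    extend-< : ∀ g z → z < n₀ → extend g z ≡ g z
    extend-< g z z<n₀ rewrite <ᵇ≡true z<n₀ = refl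

    extend-pendant : ∀ g k → extend g (n₀ + k) ≡ g w
    extend-pendant g k rewrite <ᵇ≡false {n₀ + k} (m≤m+n n₀ k) = refl

    extend-Lipschitz : ∀ g → AllEdges (EdgeLipschitz g) Es → Lipschitz G (extend g)
    extend-Lipschitz g lip = AllEdges-EdgeLipschitz⇒Lipschitz G (extend g) (AllEdges-++ Es
      (λ p q pq∈ → EdgeLipschitz-cong (extend g) g (extend-< g p (proj₁ (Es-within p q pq∈))) (extend-< g q (proj₁ (proj₂ (Es-within p q pq∈))))
                                      (lip p q pq∈))
      (AllEdges-upTo (λ k → (w , n₀ + k)) h λ k _ →
        EdgeLipschitz-cong (extend g) (λ _ → g w) (extend-< g w w<n₀) (extend-pendant g k) (n≤1+n _ , n≤1+n _)))

    core-lower-bound : ∀ g → AllEdges (EdgeLipschitz g) Es → ∀ x y → x < n₀ → y < n₀ →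
      g y ≤ g x + N₀ → g y ≤ g x + d x y
    core-lower-bound g lip x y x<n₀ y<n₀ bound =
      subst₂ (λ u v → u ≤ v + d x y) (extend-< g y y<n₀) (extend-< g x x<n₀)
        (Lipschitz⇒≤dist G (extend g) (extend-Lipschitz g lip) x y
          (subst₂ (λ u v → u ≤ v + N₀) (sym (extend-< g y y<n₀)) (sym (extend-< g x x<n₀)) bound))

    depth : ℕ → ℕ
    depth z = if z <ᵇ m + a then 0 else suc (z ∸ (m + a))

    depth-core : ∀ z → z < m + a → depth z ≡ 0
    depth-core z z<m+a rewrite <ᵇ≡true z<m+a = refl

    depth-pb : ∀ k → depth (pb k) ≡ k
    depth-pb zero    = depth-core j j<m+a
    depth-pb (suc k) rewrite <ᵇ≡false {m + a + k} (m≤m+n (m + a) k) = cong suc (m+n∸m≡n (m + a) k)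

    depth-m+a : depth (m + a) ≡ 1
    depth-m+a = subst (λ v → depth v ≡ 1) (+-identityʳ (m + a)) (depth-pb 1)

    depth-EdgeLipschitz : AllEdges (EdgeLipschitz depth) Es
    depth-EdgeLipschitz = AllEdges-Es
      (λ p q _ (p< , q<) → EdgeLipschitz-cong depth (λ _ → 0) (depth-core p p<) (depth-core q q<) (z≤n , z≤n))
      (λ _ → EdgeLipschitz-at depth (depth-core j j<m+a) depth-m+a ≤-refl z≤n)
      (λ k _ → EdgeLipschitz-at depth (depth-pb (suc k)) (depth-pb (suc (suc k))) ≤-refl (m≤n⇒m≤1+n (n≤1+n _)))

    d-pb-ordered : ∀ k l → k ≤ l → l ≤ b → d (pb k) (pb l) ≡ l ∸ k
    d-pb-ordered k l k≤l l≤b = ≤-antisym (d-pb≤ k l k≤l l≤b) (m≤n+o⇒m∸n≤o l k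
      (subst₂ (λ u v → u ≤ v + d (pb k) (pb l)) (depth-pb l) (depth-pb k)
        (core-lower-bound depth depth-EdgeLipschitz (pb k) (pb l) (pb<n₀ k (≤-trans k≤l l≤b)) (pb<n₀ l l≤b)
          (subst₂ (λ u v → u ≤ v + N₀) (sym (depth-pb l)) (sym (depth-pb k)) l≤k+N₀))))
      where
      l≤k+N₀ : l ≤ k + N₀
      l≤k+N₀ = ≤-trans l≤b (≤-trans (m≤n+m b (m + a)) (≤-trans n₀≤N₀ (m≤n+m N₀ k)))

    d-pb : ∀ k l → k ≤ b → l ≤ b → d (pb k) (pb l) ≡ ∣ k - l ∣
    d-pb k l k≤b l≤b with ≤-total k l
    ... | inj₁ k≤l = trans (d-pb-ordered k l k≤l l≤b) (sym (m≤n⇒∣m-n∣≡n∸m k≤l))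
    ... | inj₂ l≤k = trans (d-sym (pb k) (pb l)) (trans (d-pb-ordered l k l≤k k≤b) (sym (m≤n⇒∣n-m∣≡n∸m l≤k)))

    module ThroughVj (x : ℕ) (x<m+a : x < m + a) where

      toCore : ℕ → ℕ
      toCore z = if z <ᵇ m + a then z else j

      potential : ℕ → ℕ
      potential z = d x (toCore z) + depth z

      potential-core : ∀ z → z < m + a → potential z ≡ d x z
      potential-core z z< rewrite <ᵇ≡true z< = +-identityʳ (d x z)

      potential-x : potential x ≡ 0
      potential-x = trans (potential-core x x<m+a) (dist-refl G x)

      potential-pb : ∀ k → potential (pb k) ≡ d x j + k
      potential-pb zero    = trans (potential-core j j<m+a) (sym (+-identityʳ (d x j)))
      potential-pb (suc k) = cong₂ _+_ (cong (d x) toCore-Pb) (depth-pb (suc k))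
        where
        toCore-Pb : toCore (m + a + k) ≡ j
        toCore-Pb rewrite <ᵇ≡false {m + a + k} (m≤m+n (m + a) k) = refl

      potential-m+a : potential (m + a) ≡ d x j + 1
      potential-m+a = subst (λ v → potential v ≡ d x j + 1) (+-identityʳ (m + a)) (potential-pb 1)

      potential-EdgeLipschitz : AllEdges (EdgeLipschitz potential) Es
      potential-EdgeLipschitz = AllEdges-Es
        (λ p q pq∈ (p< , q<) → EdgeLipschitz-cong potential (d x) (potential-core p p<) (potential-core q q<)
           (dist-EdgeLipschitz G bounded x p q (Es⊆ (coreEdges⊆Es pq∈))))
        (λ _ → EdgeLipschitz-at potential (potential-pb 0) potential-m+a
           (≤-reflexive (+-suc (d x j) 0)) (m≤n⇒m≤1+n (+-monoʳ-≤ (d x j) z≤n)))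
        (λ k _ → EdgeLipschitz-at potential (potential-pb (suc k)) (potential-pb (suc (suc k)))
           (≤-reflexive (+-suc (d x j) (suc k))) (≤-trans (+-monoʳ-≤ (d x j) (n≤1+n (suc k))) (n≤1+n _)))

    -- v_j is a cut vertex separating P_b from the rest of G*.
    d-core-pb : ∀ x → x < m + a → ∀ t → t ≤ b → d x (pb t) ≡ d x j + t
    d-core-pb x x<m+a t t≤b = ≤-antisym
      (≤-trans (dist-triangle G x j (pb t)) (+-monoʳ-≤ (d x j) (d-pb≤ 0 t z≤n t≤b)))
      (subst₂ (λ u v → u ≤ v + d x (pb t)) (potential-pb t) potential-x
        (core-lower-bound potential potential-EdgeLipschitz x (pb t) (<-≤-trans x<m+a m+a≤n₀) (pb<n₀ t t≤b)
          (subst₂ (λ u v → u ≤ v + N₀) (sym (potential-pb t)) (sym potential-x) bound)))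
      where
      open ThroughVj x x<m+a
      bound : d x j + t ≤ 0 + N₀
      bound = ≤-trans (+-mono-≤ (<⇒≤ (subst (_< m + a) (d-sym j x) (d-j-core x x<m+a))) t≤b) n₀≤N₀

    module Pendant (k : ℕ) (k<h : k < h) where

      p : ℕ
      p = n₀ + k

      ≢p : ∀ z → z < n₀ → z ≢ p
      ≢p z z<n₀ z≡p = <⇒≱ z<n₀ (≤-trans (m≤m+n n₀ k) (≤-reflexive (sym z≡p)))

      w≢p : w ≢ p
      w≢p = ≢p w w<n₀

      potential : ℕ → ℕ
      potential z = if z ≡ᵇ p then 0 else suc (d w z)

      potential-p : potential p ≡ 0
      potential-p rewrite ≡ᵇ-refl p = refl

      potential-≢ : ∀ z → z ≢ p → potential z ≡ suc (d w z)
      potential-≢ z z≢p with z ≡ᵇ p in e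
      ... | true  = ⊥-elim (z≢p (≡ᵇ≡true⁻ z p e))
      ... | false = refl

      potential-Lipschitz : Lipschitz G potential
      potential-Lipschitz = AllEdges-EdgeLipschitz⇒Lipschitz G potential (AllEdges-++ Es
        (λ q r qr∈ → EdgeLipschitz-cong potential (λ z → suc (d w z))
           (potential-≢ q (≢p q (proj₁ (Es-within q r qr∈)))) (potential-≢ r (≢p r (proj₁ (proj₂ (Es-within q r qr∈)))))
           (EdgeLipschitz-suc (d w) (dist-EdgeLipschitz G bounded w q r (Es⊆ qr∈))))
        (AllEdges-upTo (λ k′ → (w , n₀ + k′)) h pendant-edge))
        where
        pendant-edge : ∀ k′ → k′ < h → EdgeLipschitz potential w (n₀ + k′)
        pendant-edge k′ k′<h with k′ ≟ k
        ... | yes refl = EdgeLipschitz-at potential (trans (potential-≢ w w≢p) (cong suc (dist-refl G w))) potential-p z≤n ≤-refl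
        ... | no  k′≢k = EdgeLipschitz-cong potential (λ z → suc (d w z))
              (potential-≢ w w≢p) (potential-≢ (n₀ + k′) (λ e → k′≢k (+-cancelˡ-≡ n₀ k′ k e)))
              (EdgeLipschitz-suc (d w) (dist-EdgeLipschitz G bounded w w (n₀ + k′) (pendantEdges⊆ (pendantEdges-∋ w n₀ h k′ k′<h))))

      d-pendant : ∀ y → y ≢ p → d w y < N₀ → d p y ≡ suc (d w y)
      d-pendant y y≢p dwy<N₀ = ≤-antisym
        (≤-trans (dist-triangle G p w y) (+-monoˡ-≤ (d w y) (subst (_≤ 1) (d-sym w p) (edge⇒d≤1 (pendantEdges⊆ (pendantEdges-∋ w n₀ h k k<h))))))
        (subst₂ (λ u v → u ≤ v + d p y) (potential-≢ y y≢p) potential-p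
          (Lipschitz⇒≤dist G potential potential-Lipschitz p y
            (subst₂ (λ u v → u ≤ v + N₀) (sym (potential-≢ y y≢p)) (sym potential-p) dwy<N₀)))

      d-w-pendant : d w p ≡ 1
      d-w-pendant = trans (d-sym w p) (trans (d-pendant w w≢p (subst (_< N₀) (sym (dist-refl G w)) 0<N₀)) (cong suc (dist-refl G w)))
        where
        0<N₀ : 0 < N₀
        0<N₀ = ≤-trans (s≤s z≤n) (≤-trans w<n₀ n₀≤N₀)

    Δ : ℕ → ℕ
    Δ x = ∑ (d x) n₀

    D-split : ∀ x → D G x ≡ Δ x + ∑ (λ k → d x (n₀ + k)) h
    D-split x = trans (sum-map-upTo (d x) N₀) (∑-split (d x) n₀ h)

    -- Reachability is what rules out the junk value of dist in the pendant distances.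
    module Reachable (reach : ∀ y → y < N₀ → d w y < N₀) where
      open Pendant using (d-pendant; d-w-pendant; ≢p)

      D-core : ∀ x → x < n₀ → D G x ≡ Δ x + h * suc (d x w)
      D-core x x<n₀ = trans (D-split x) (cong (Δ x +_) (trans (∑-cong h λ k k<h →
          trans (d-sym x (n₀ + k)) (trans (d-pendant k k<h x (≢p k k<h x x<n₀) (reach x (<-≤-trans x<n₀ n₀≤N₀)))
                                          (cong suc (d-sym w x))))
        (∑-const (suc (d x w)) h)))

      D-w : D G w ≡ Δ w + h
      D-w = trans (D-split w) (cong (Δ w +_) (trans (∑-cong h (λ k k<h → d-w-pendant k k<h)) (trans (∑-const 1 h) (*-identityʳ h))))

      D-pendant : ∀ k → k < h → D G (n₀ + k) + 2 ≡ N₀ + D G w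
      D-pendant k k<h = begin
        D G (n₀ + k) + 2
          ≡⟨ cong₂ _+_ (sum-map-upTo (d (n₀ + k)) N₀) (cong suc (sym (d-w-pendant k k<h))) ⟩
        ∑ (d (n₀ + k)) N₀ + suc (d w (n₀ + k))
          ≡⟨ ∑-replace (d (n₀ + k)) (λ y → suc (d w y)) N₀ (n₀ + k) (+-monoʳ-< n₀ k<h)
               (λ y y<N₀ y≢p → d-pendant k k<h y y≢p (reach y y<N₀)) (dist-refl G (n₀ + k)) ⟩
        ∑ (λ y → 1 + d w y) N₀
          ≡⟨ ∑-+ (λ _ → 1) (d w) N₀ ⟩
        ∑ (λ _ → 1) N₀ + ∑ (d w) N₀
          ≡⟨ cong₂ _+_ (trans (∑-const 1 N₀) (*-identityʳ N₀)) (sym (sum-map-upTo (d w) N₀)) ⟩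
        N₀ + D G w ∎
        where open ≡-Reasoning

      ∑edges-D-Es : ∑edges (λ p q → D G p + D G q) Es ≡
                    ∑edges (λ p q → Δ p + Δ q) Es + h * ∑edges (λ p q → suc (d p w) + suc (d q w)) Es
      ∑edges-D-Es = begin
        ∑edges (λ p q → D G p + D G q) Es
          ≡⟨ ∑edges-cong _ _ Es (λ p q pq∈ → trans
               (cong₂ _+_ (D-core p (proj₁ (Es-within p q pq∈))) (D-core q (proj₁ (proj₂ (Es-within p q pq∈)))))
               (regroup (Δ p) (Δ q) h (suc (d p w)) (suc (d q w)))) ⟩
        ∑edges (λ p q → Δ p + Δ q + h * (suc (d p w) + suc (d q w))) Es
          ≡⟨ ∑edges-+ (λ p q → Δ p + Δ q) (λ p q → h * (suc (d p w) + suc (d q w))) Es ⟩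
        ∑edges (λ p q → Δ p + Δ q) Es + ∑edges (λ p q → h * (suc (d p w) + suc (d q w))) Es
          ≡⟨ cong (∑edges (λ p q → Δ p + Δ q) Es +_) (∑edges-*ˡ h (λ p q → suc (d p w) + suc (d q w)) Es) ⟩
        ∑edges (λ p q → Δ p + Δ q) Es + h * ∑edges (λ p q → suc (d p w) + suc (d q w)) Es ∎
        where
        open ≡-Reasoning
        regroup : ∀ A B c X Y → A + c * X + (B + c * Y) ≡ A + B + c * (X + Y)
        regroup = solve-∀

      ∑edges-D-pendants : ∑edges (λ p q → D G p + D G q) (pendantEdges w n₀ h) + h * 2 ≡ h * (D G w + (N₀ + D G w))
      ∑edges-D-pendants = begin
        ∑edges (λ p q → D G p + D G q) (pendantEdges w n₀ h) + h * 2
          ≡⟨ cong₂ _+_ (∑edges-applyUpTo (λ p q → D G p + D G q) (λ k → (w , n₀ + k)) (λ z → z) h) (sym (∑-const 2 h)) ⟩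
        ∑ (λ k → D G w + D G (n₀ + k)) h + ∑ (λ _ → 2) h
          ≡⟨ sym (∑-+ (λ k → D G w + D G (n₀ + k)) (λ _ → 2) h) ⟩
        ∑ (λ k → D G w + D G (n₀ + k) + 2) h
          ≡⟨ ∑-cong h (λ k k<h → trans (+-assoc (D G w) (D G (n₀ + k)) 2) (cong (D G w +_) (D-pendant k k<h))) ⟩
        ∑ (λ _ → D G w + (N₀ + D G w)) h
          ≡⟨ ∑-const _ h ⟩
        h * (D G w + (N₀ + D G w)) ∎
        where open ≡-Reasoning

      D′-decomposition : D′ G + h * 2 ≡ ∑edges (λ p q → Δ p + Δ q) Es
                                 + h * ∑edges (λ p q → suc (d p w) + suc (d q w)) Es
                                 + h * (D G w + (N₀ + D G w))
      D′-decomposition = begin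
        D′ G + h * 2
          ≡⟨ cong (_+ h * 2) (trans D′≡∑edges (∑edges-++ _ Es (pendantEdges w n₀ h))) ⟩
        ∑edges (λ p q → D G p + D G q) Es + ∑edges (λ p q → D G p + D G q) (pendantEdges w n₀ h) + h * 2
          ≡⟨ +-assoc (∑edges (λ p q → D G p + D G q) Es) _ _ ⟩
        ∑edges (λ p q → D G p + D G q) Es + (∑edges (λ p q → D G p + D G q) (pendantEdges w n₀ h) + h * 2)
          ≡⟨ cong₂ _+_ ∑edges-D-Es ∑edges-D-pendants ⟩
        ∑edges (λ p q → Δ p + Δ q) Es + h * ∑edges (λ p q → suc (d p w) + suc (d q w)) Es + h * (D G w + (N₀ + D G w)) ∎
        where open ≡-Reasoning

    reachable-from-pb : ∀ t → t ≤ b → w ≡ pb t → ∀ y → y < N₀ → d w y < N₀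
    reachable-from-pb t t≤b refl y y<N₀ with vertex-cases y y<N₀
    ... | inj₁ y<m+a = begin-strict
      d (pb t) y      ≡⟨ d-sym (pb t) y ⟩
      d y (pb t)      ≡⟨ d-core-pb y y<m+a t t≤b ⟩
      d y j + t       ≡⟨ cong (_+ t) (d-sym y j) ⟩
      d j y + t       <⟨ +-mono-<-≤ (d-j-core y y<m+a) t≤b ⟩
      m + a + b       ≤⟨ n₀≤N₀ ⟩
      N₀              ∎
      where open ≤-Reasoning
    ... | inj₂ (inj₁ (k , k<b , refl)) = begin-strict
      d (pb t) (pb (suc k))  ≡⟨ d-pb t (suc k) t≤b k<b ⟩
      ∣ t - suc k ∣          ≤⟨ ∣m-n∣≤m⊔n t (suc k) ⟩
      t ⊔ suc k              ≤⟨ ⊔-lub t≤b k<b ⟩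
      b                      <⟨ +-monoˡ-≤ b (≤-trans (s≤s z≤n) (≤-trans 3≤m m≤m+a)) ⟩
      m + a + b              ≤⟨ n₀≤N₀ ⟩
      N₀                     ∎
      where open ≤-Reasoning
    ... | inj₂ (inj₂ (k , k<h , refl)) =
      subst (_< N₀) (sym (Pendant.d-w-pendant k k<h)) (≤-trans (s≤s (s≤s z≤n)) (≤-trans 3≤m (≤-trans m≤m+a (≤-trans m+a≤n₀ n₀≤N₀))))

  dist-core-invariant≤ : ∀ w w′ → w < n₀ → w′ < n₀ → ∀ x y → x < n₀ → y < n₀ → dist (Gpend w′) x y ≤ dist (Gpend w) x y
  dist-core-invariant≤ w w′ w<n₀ w′<n₀ x y x<n₀ y<n₀ =
    subst (λ v → dist (Gpend w′) x y ≤ v + dist (Gpend w) x y) (dist-refl (Gpend w′) x)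
      (AtVertex.core-lower-bound w w<n₀ (dist (Gpend w′) x)
        (λ p q pq∈ → dist-EdgeLipschitz (Gpend w′) (AtVertex.bounded w′ w′<n₀) x p q (∈-++⁺ˡ pq∈)) x y x<n₀ y<n₀
        (subst (λ v → dist (Gpend w′) x y ≤ v + N₀) (sym (dist-refl (Gpend w′) x)) (dist-≤-N (Gpend w′) x y)))

  -- Pendant vertices are leaves, so they lie on no shortest path between two vertices of G*.
  dist-core-invariant : ∀ w w′ → w < n₀ → w′ < n₀ → ∀ x y → x < n₀ → y < n₀ → dist (Gpend w) x y ≡ dist (Gpend w′) x y
  dist-core-invariant w w′ w<n₀ w′<n₀ x y x<n₀ y<n₀ =
    ≤-antisym (dist-core-invariant≤ w′ w w′<n₀ w<n₀ x y x<n₀ y<n₀) (dist-core-invariant≤ w w′ w<n₀ w′<n₀ x y x<n₀ y<n₀)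

  j<n₀ : j < n₀
  j<n₀ = pb<n₀ 0 z≤n

  module J = AtVertex j j<n₀

  -- Quantities of G*, measured in Gpend j; by dist-core-invariant any other w gives the same values.
  X₀ C₀ A₀ ΔA : ℕ
  X₀ = ∑edges (λ p q → J.Δ p + J.Δ q) Es
  C₀ = ∑edges (λ p q → suc (J.d p j) + suc (J.d q j)) (cycleEdges m)
  A₀ = ∑edges (λ p q → suc (J.d p j) + suc (J.d q j)) (pathEdges i m a)
  ΔA = ∑ (J.d j) (m + a)

  P : ℕ → ℕ
  P t = ∑ (λ k → ∣ suc k - t ∣) b

  -- D′ (Gpend (pb t)) + 2h in closed form, with P t abstracted as p.
  D′-formula : ℕ → ℕ → ℕ
  D′-formula t p = X₀ + h * ((C₀ + m * (2 * t)) + ((A₀ + a * (2 * t)) + (2 * t + b + 2 * p)))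
                      + h * ((ΔA + (m + a) * t + p + h) + (N₀ + (ΔA + (m + a) * t + p + h)))

  module AtPb (t : ℕ) (t≤b : t ≤ b) where

    U : ℕ
    U = pb t

    U<n₀ : U < n₀
    U<n₀ = pb<n₀ t t≤b

    module V = AtVertex U U<n₀
    open V.Reachable (V.reachable-from-pb t t≤b refl)
    open ≡-Reasoning

    d≡d₀ : ∀ x y → x < n₀ → y < n₀ → V.d x y ≡ J.d x y
    d≡d₀ = dist-core-invariant U j U<n₀ j<n₀

    Δ≡Δ₀ : ∀ x → x < n₀ → V.Δ x ≡ J.Δ x
    Δ≡Δ₀ x x<n₀ = ∑-cong n₀ (λ y y<n₀ → d≡d₀ x y x<n₀ y<n₀)

    Δ-U : V.Δ U ≡ ΔA + (m + a) * t + P t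
    Δ-U = begin
      V.Δ U                                                 ≡⟨ Δ≡Δ₀ U U<n₀ ⟩
      J.Δ U                                                 ≡⟨ ∑-split (J.d U) (m + a) b ⟩
      ∑ (J.d U) (m + a) + ∑ (λ k → J.d U (m + a + k)) b    ≡⟨ cong₂ _+_ core-part path-part ⟩
      ΔA + (m + a) * t + P t                                ∎
      where
      core-part : ∑ (J.d U) (m + a) ≡ ΔA + (m + a) * t
      core-part = trans (∑-cong (m + a) (λ y y< → trans (J.d-sym U y) (trans (J.d-core-pb y y< t t≤b) (cong (_+ t) (J.d-sym y j)))))
                        (trans (∑-+ (J.d j) (λ _ → t) (m + a)) (cong (ΔA +_) (∑-const t (m + a))))
      path-part : ∑ (λ k → J.d U (m + a + k)) b ≡ P t
      path-part = ∑-cong b (λ k k<b → trans (J.d-sym U (pb (suc k))) (J.d-pb (suc k) t k<b t≤b))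

    X-U : ∑edges (λ p q → V.Δ p + V.Δ q) Es ≡ X₀
    X-U = ∑edges-cong _ _ Es (λ p q pq∈ →
      cong₂ _+_ (Δ≡Δ₀ p (proj₁ (Es-within p q pq∈))) (Δ≡Δ₀ q (proj₁ (proj₂ (Es-within p q pq∈)))))

    F₀ : ℕ → ℕ → ℕ
    F₀ p q = suc (J.d p U) + suc (J.d q U)

    core-shift : ∀ es → AllEdges CoreEdge es →
      ∑edges F₀ es ≡ ∑edges (λ p q → suc (J.d p j) + suc (J.d q j)) es + length es * (2 * t)
    core-shift es core = begin
      ∑edges F₀ es
        ≡⟨ ∑edges-cong _ _ es (λ p q pq∈ → trans
             (cong₂ (λ u v → suc u + suc v) (J.d-core-pb p (proj₁ (core p q pq∈)) t t≤b) (J.d-core-pb q (proj₂ (core p q pq∈)) t t≤b))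
             (regroup (J.d p j) (J.d q j) t)) ⟩
      ∑edges (λ p q → suc (J.d p j) + suc (J.d q j) + 2 * t) es
        ≡⟨ ∑edges-+ (λ p q → suc (J.d p j) + suc (J.d q j)) (λ _ _ → 2 * t) es ⟩
      ∑edges (λ p q → suc (J.d p j) + suc (J.d q j)) es + ∑edges (λ _ _ → 2 * t) es
        ≡⟨ cong (∑edges (λ p q → suc (J.d p j) + suc (J.d q j)) es +_) (∑edges-const (2 * t) es) ⟩
      ∑edges (λ p q → suc (J.d p j) + suc (J.d q j)) es + length es * (2 * t) ∎
      where
      regroup : ∀ x y t → suc (x + t) + suc (y + t) ≡ suc x + suc y + 2 * t
      regroup = solve-∀

    Pb-sum : ∑edges F₀ (pathEdges j (m + a) b) ≡ 2 * t + b + 2 * P t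
    Pb-sum = +-cancelʳ-≡ (suc s) _ _ (begin
      ∑edges F₀ (pathEdges j (m + a) b) + suc s
        ≡⟨ cong (∑edges F₀ (pathEdges j (m + a) b) +_) (sym f-last) ⟩
      ∑edges F₀ (pathEdges j (m + a) b) + f (m + a + (b ∸ 1))
        ≡⟨ ∑edges-pathEdges-telescope f j (m + a) b 1≤b ⟩
      suc (J.d j U) + 2 * ∑ (λ k → f (m + a + k)) b
        ≡⟨ cong₂ (λ u v → suc u + 2 * v) (J.d-pb 0 t z≤n t≤b) ∑f ⟩
      suc t + 2 * (b + P t)
        ≡⟨ cong (λ v → suc t + 2 * (v + P t)) (sym t+s≡b) ⟩
      suc t + 2 * (t + s + P t)
        ≡⟨ regroup t s (P t) ⟩
      2 * t + (t + s) + 2 * P t + suc s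
        ≡⟨ cong (λ v → 2 * t + v + 2 * P t + suc s) t+s≡b ⟩
      2 * t + b + 2 * P t + suc s ∎)
      where
      s : ℕ
      s = b ∸ t
      t+s≡b : t + s ≡ b
      t+s≡b = m+[n∸m]≡n t≤b
      f : ℕ → ℕ
      f z = suc (J.d z U)
      suc[b∸1]≡b : suc (b ∸ 1) ≡ b
      suc[b∸1]≡b = m+[n∸m]≡n 1≤b
      f-last : f (m + a + (b ∸ 1)) ≡ suc s
      f-last = cong suc (trans (J.d-pb (suc (b ∸ 1)) t (≤-reflexive suc[b∸1]≡b) t≤b)
                               (trans (cong ∣_- t ∣ suc[b∸1]≡b) (m≤n⇒∣n-m∣≡n∸m t≤b)))
      ∑f : ∑ (λ k → f (m + a + k)) b ≡ b + P t
      ∑f = trans (∑-cong b (λ k k<b → cong suc (J.d-pb (suc k) t k<b t≤b)))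
                 (trans (∑-+ (λ _ → 1) (λ k → ∣ suc k - t ∣) b) (cong (_+ P t) (trans (∑-const 1 b) (*-identityʳ b))))
      regroup : ∀ t s p → suc t + 2 * (t + s + p) ≡ 2 * t + (t + s) + 2 * p + suc s
      regroup = solve-∀

    T-U : ∑edges (λ p q → suc (V.d p U) + suc (V.d q U)) Es ≡ (C₀ + m * (2 * t)) + ((A₀ + a * (2 * t)) + (2 * t + b + 2 * P t))
    T-U = begin
      ∑edges (λ p q → suc (V.d p U) + suc (V.d q U)) Es
        ≡⟨ ∑edges-cong _ F₀ Es (λ p q pq∈ → cong₂ (λ u v → suc u + suc v)
             (d≡d₀ p U (proj₁ (Es-within p q pq∈)) U<n₀) (d≡d₀ q U (proj₁ (proj₂ (Es-within p q pq∈))) U<n₀)) ⟩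
      ∑edges F₀ Es
        ≡⟨ ∑edges-++ F₀ (cycleEdges m) (pathEdges i m a ++ pathEdges j (m + a) b) ⟩
      ∑edges F₀ (cycleEdges m) + ∑edges F₀ (pathEdges i m a ++ pathEdges j (m + a) b)
        ≡⟨ cong (∑edges F₀ (cycleEdges m) +_) (∑edges-++ F₀ (pathEdges i m a) (pathEdges j (m + a) b)) ⟩
      ∑edges F₀ (cycleEdges m) + (∑edges F₀ (pathEdges i m a) + ∑edges F₀ (pathEdges j (m + a) b))
        ≡⟨ cong₂ _+_ (trans (core-shift (cycleEdges m) cycleEdges-core)
                            (cong (λ v → C₀ + v * (2 * t)) (length-cycleEdges m (≤-trans (s≤s z≤n) 3≤m))))
                     (cong₂ _+_ (trans (core-shift (pathEdges i m a) pathEdges-i-core)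
                                       (cong (λ v → A₀ + v * (2 * t)) (length-pathEdges i m a)))
                                Pb-sum) ⟩
      (C₀ + m * (2 * t)) + ((A₀ + a * (2 * t)) + (2 * t + b + 2 * P t)) ∎

    D-U : D V.G U ≡ ΔA + (m + a) * t + P t + h
    D-U = trans D-w (cong (_+ h) Δ-U)

    D′-Gpend-pb : D′ (Gpend U) + h * 2 ≡ D′-formula t (P t)
    D′-Gpend-pb = trans D′-decomposition (cong₃ (λ x y z → x + h * y + h * (z + (N₀ + z))) X-U T-U D-U)
      where
      cong₃ : ∀ (f : ℕ → ℕ → ℕ → ℕ) {x x′ y y′ z z′} → x ≡ x′ → y ≡ y′ → z ≡ z′ → f x y z ≡ f x′ y′ z′
      cong₃ f refl refl refl = refl

  D′-difference : ∀ t → t ≤ b → D′ (Gpend j) + 4 * h * t * (m + a) ≡ D′ (Gpend (pb t)) + 4 * h * t * (b ∸ t) + 2 * h * t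
  D′-difference t t≤b = +-cancelʳ-≡ (h * 2) _ _ (begin
    D′ (Gpend j) + 4 * h * t * (m + a) + h * 2
      ≡⟨ xy∙z≈xz∙y (D′ (Gpend j)) _ _ ⟩
    D′ (Gpend j) + h * 2 + 4 * h * t * (m + a)
      ≡⟨ cong (_+ 4 * h * t * (m + a)) (AtPb.D′-Gpend-pb 0 z≤n) ⟩
    D′-formula 0 (P 0) + 4 * h * t * (m + a)
      ≡⟨ cong (λ p → D′-formula 0 p + 4 * h * t * (m + a)) P0≡ ⟩
    D′-formula 0 (P t + t * s + t) + 4 * h * t * (m + a)
      ≡⟨ move-pendants X₀ C₀ A₀ ΔA N₀ m a b h t s (P t) ⟩
    D′-formula t (P t) + (4 * h * t * s + 2 * h * t)
      ≡⟨ cong (_+ (4 * h * t * s + 2 * h * t)) (sym (AtPb.D′-Gpend-pb t t≤b)) ⟩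
    D′ (Gpend (pb t)) + h * 2 + (4 * h * t * s + 2 * h * t)
      ≡⟨ regroup (D′ (Gpend (pb t))) (h * 2) (4 * h * t * s) (2 * h * t) ⟩
    D′ (Gpend (pb t)) + 4 * h * t * s + 2 * h * t + h * 2 ∎)
    where
    open ≡-Reasoning
    open import Algebra.Properties.CommutativeSemigroup +-commutativeSemigroup using (xy∙z≈xz∙y)
    s : ℕ
    s = b ∸ t
    P0≡ : P 0 ≡ P t + t * s + t
    P0≡ = subst (λ v → ∑ suc v ≡ ∑ (λ k → ∣ suc k - t ∣) v + t * s + t) (m+[n∸m]≡n t≤b) (∑-suc-∣-∣ t s)
    regroup : ∀ x y z w → x + y + (z + w) ≡ x + z + w + y
    regroup = solve-∀
    move-pendants : ∀ X C A Δ N m a b h t s p →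
      X + h * ((C + m * (2 * 0)) + ((A + a * (2 * 0)) + (2 * 0 + b + 2 * (p + t * s + t))))
        + h * ((Δ + (m + a) * 0 + (p + t * s + t) + h) + (N + (Δ + (m + a) * 0 + (p + t * s + t) + h)))
        + 4 * h * t * (m + a)
      ≡ X + h * ((C + m * (2 * t)) + ((A + a * (2 * t)) + (2 * t + b + 2 * p)))
        + h * ((Δ + (m + a) * t + p + h) + (N + (Δ + (m + a) * t + p + h)))
        + (4 * h * t * s + 2 * h * t)
    move-pendants = solve-∀

  D′-G2-G1 : ∀ t → 1 ≤ t → t ≤ b →
    D′ (G2 m i j a b h) + 4 * h * t * (m + a) ≡ D′ (G1 m i j a b t h) + 4 * h * t * (b ∸ t) + 2 * h * t
  D′-G2-G1 (suc t) _ t<b = subst (λ w → D′ (Gpend j) + 4 * h * suc t * (m + a) ≡ D′ (Gpend w) + 4 * h * suc t * (b ∸ suc t) + 2 * h * suc t)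
    (cong (_∸ 1) (sym (+-suc (m + a) t))) (D′-difference (suc t) t<b)

module IntegerDifference where
  open import Data.Nat using (suc; _≤_)
  open import Data.Integer using (ℤ; +_; _+_; _-_; _*_)
  open import Data.Integer.Properties using (pos-+; pos-*; +-assoc)
  open import Data.Integer.Tactic.RingSolver using (solve-∀)
  open import Relation.Binary.PropositionalEquality
  open ≡-Reasoning
  import Data.Nat as ℕ

  pos-*³ : ∀ x y z → + (x ℕ.* y ℕ.* z) ≡ + x * + y * + z
  pos-*³ x y z = trans (pos-* (x ℕ.* y) z) (cong (_* + z) (pos-* x y))

  pos-*⁴ : ∀ x y z w → + (x ℕ.* y ℕ.* z ℕ.* w) ≡ + x * + y * + z * + w
  pos-*⁴ x y z w = trans (pos-* (x ℕ.* y ℕ.* z) w) (cong (_* + w) (pos-*³ x y z))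

  ℕ-balance⇒ℤ-difference : ∀ D₂ D₁ h t s m a → 1 ≤ a →
    D₂ ℕ.+ 4 ℕ.* h ℕ.* t ℕ.* (m ℕ.+ a) ≡ D₁ ℕ.+ 4 ℕ.* h ℕ.* t ℕ.* s ℕ.+ 2 ℕ.* h ℕ.* t →
    + D₂ - + D₁ ≡ + 2 * + h * + t * (+ 2 * (+ s - + (a ℕ.+ m ℕ.∸ 1)) - + 1)
  ℕ-balance⇒ℤ-difference D₂ D₁ h t s m (suc a) _ balance = begin
    + D₂ - + D₁
      ≡⟨ solve₁ (+ D₂) (+ D₁) K ⟩
    (+ D₂ + K) - K - + D₁
      ≡⟨ cong (λ v → v - K - + D₁) balanceℤ ⟩
    (+ D₁ + L) - K - + D₁
      ≡⟨ solve₂ (+ D₁) (+ h) (+ t) (+ s) (+ m) (+ a) ⟩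
    + 2 * + h * + t * (+ 2 * (+ s - (+ a + + m)) - + 1)
      ≡⟨ cong (λ v → + 2 * + h * + t * (+ 2 * (+ s - v) - + 1)) (sym (pos-+ a m)) ⟩
    + 2 * + h * + t * (+ 2 * (+ s - + (a ℕ.+ m)) - + 1) ∎
    where
    solve₁ : ∀ A B K → A - B ≡ (A + K) - K - B
    solve₁ = solve-∀
    solve₂ : ∀ B h t s m a → (B + (+ 4 * h * t * s + + 2 * h * t)) - + 4 * h * t * (m + (+ 1 + a)) - B
                             ≡ + 2 * h * t * (+ 2 * (s - (a + m)) - + 1)
    solve₂ = solve-∀
    K L : ℤ
    K = + 4 * + h * + t * (+ m + (+ 1 + + a))
    L = + 4 * + h * + t * + s + + 2 * + h * + t
    balanceℤ : + D₂ + K ≡ + D₁ + L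
    balanceℤ = begin
      + D₂ + K
        ≡⟨ cong (λ v → + D₂ + + 4 * + h * + t * v) (trans (cong (λ v → + m + v) (sym (pos-+ 1 a))) (sym (pos-+ m (suc a)))) ⟩
      + D₂ + + 4 * + h * + t * + (m ℕ.+ suc a)
        ≡⟨ cong (λ v → + D₂ + v) (sym (pos-*⁴ 4 h t (m ℕ.+ suc a))) ⟩
      + D₂ + + (4 ℕ.* h ℕ.* t ℕ.* (m ℕ.+ suc a))
        ≡⟨ sym (pos-+ D₂ _) ⟩
      + (D₂ ℕ.+ 4 ℕ.* h ℕ.* t ℕ.* (m ℕ.+ suc a))
        ≡⟨ cong +_ balance ⟩
      + (D₁ ℕ.+ 4 ℕ.* h ℕ.* t ℕ.* s ℕ.+ 2 ℕ.* h ℕ.* t)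
        ≡⟨ trans (pos-+ _ (2 ℕ.* h ℕ.* t)) (cong₂ _+_ (trans (pos-+ D₁ _) (cong (λ v → + D₁ + v) (pos-*⁴ 4 h t s))) (pos-*³ 2 h t)) ⟩
      + D₁ + + 4 * + h * + t * + s + + 2 * + h * + t
        ≡⟨ +-assoc (+ D₁) (+ 4 * + h * + t * + s) (+ 2 * + h * + t) ⟩
      + D₁ + L ∎
open import Data.Nat.Properties using (≤-trans; <⇒≤; m∸n≤m)
open import Data.Integer using (ℤ; +_; _-_; _*_)

lemma3 : (m i j a b t h : ℕ) → 3 ≤ m → i < m → j < m → i ≢ j →
    1 ≤ a → 2 ≤ b → 1 ≤ h → 1 ≤ t → t ≤ b ∸ 1 →
    (+ D′ (G2 m i j a b h)) - (+ D′ (G1 m i j a b t h))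
      ≡ + 2 * + h * + t * (+ 2 * ((+ (b ∸ t)) - (+ (a ℕ.+ m ∸ 1))) - + 1)
lemma3 m i j a b t h 3≤m i<m j<m _ 1≤a 2≤b _ 1≤t t≤b∸1 =
  IntegerDifference.ℕ-balance⇒ℤ-difference _ _ h t (b ∸ t) m a 1≤a
    (PendantGraphs.D′-G2-G1 m i j a b h 3≤m i<m j<m 1≤a (<⇒≤ 2≤b) t 1≤t (≤-trans t≤b∸1 (m∸n≤m b 1)))
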